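{- Let $G$ be a graph which is simply reducible to a graph $H$. If $H$ is simply bad, then $G$ is simply bad.
   Context: Graphs are finite and simple. $G$ is simply reducible to $H$ if $G$ has a cycle $C$ of odd length such that $H$ is obtained from $G$ by contracting $C$ to a single vertex. For a graph $G$ with a $1$-factor $F$: a cycle $C$ is $F$-alternating if $|E(C)|=2|E(F)\cap E(C)|$; in an orientation of $G$ an even cycle $C$ is evenly (resp. oddly) oriented if, for either direction of traversal, the number of edges of $C$ directed along the traversal is even (resp. odd); a zero-sum $F$-set is a finite family $\{C_1,\ldots,C_k\}$ of $F$-alternating cycles such that every edge of $G$ lies in an even number of its members, and it is an odd $F$-set if $k$ is odd. A graph $G$ is simply bad if it has a $1$-factor $F$ such that $G$ has an odd $F$-set $\mathcal{A}$ and an orientation in which every member of $\mathcal{A}$ is evenly oriented. -}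

module Defs where

open import Data.Nat using (ℕ; zero; suc; _+_; _*_; _≤_; _%_)
open import Data.Bool using (Bool; true; false; not; _∧_; _∨_; if_then_else_)
open import Data.Fin using (Fin; _≟_)
open import Data.List using (List; []; _∷_; _++_; length; map)
open import Data.Bool.ListAction using (any)
open import Data.List.Relation.Unary.All using (All)
open import Data.List.Relation.Unary.Unique.Propositional using (Unique)
open import Data.List.Membership.Propositional using (_∈_)
open import Data.Product using (Σ; _×_; _,_; ∃; ∃-syntax)
open import Data.Sum using (_⊎_)
open import Relation.Nullary using (¬_; does)
open import Relation.Binary.PropositionalEquality using (_≡_; _≢_)
open import Function.Bundles using (_⇔_)

record Graph : Set₁ where
  field
    n     : ℕ
    Adj   : Fin n → Fin n → Set
    sym   : ∀ {u v} → Adj u v → Adj v u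
    irrefl : ∀ {u} → ¬ Adj u u
open Graph public

Even Odd : ℕ → Set
Even k = k % 2 ≡ 0
Odd  k = k % 2 ≡ 1

countᵇ : ∀ {a} {A : Set a} → (A → Bool) → List A → ℕ
countᵇ p [] = 0
countᵇ p (x ∷ xs) = (if p x then 1 else 0) + countᵇ p xs

pairs : ∀ {a} {A : Set a} → List A → List (A × A)
pairs (x ∷ y ∷ r) = (x , y) ∷ pairs (y ∷ r)
pairs _ = []

cycEdges : ∀ {a} {A : Set a} → List A → List (A × A)
cycEdges [] = []
cycEdges (x ∷ xs) = pairs (x ∷ xs ++ x ∷ [])

IsCycle : (G : Graph) → List (Fin (n G)) → Set
IsCycle G vs = (3 ≤ length vs) × Unique vs × All (λ e → Adj G (Data.Product.proj₁ e) (Data.Product.proj₂ e)) (cycEdges vs)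

-- A 1-factor (perfect matching) F of G, given by the partner map:
-- the F-edges are exactly the pairs {v , partner v}.
record OneFactor (G : Graph) : Set where
  field
    partner     : Fin (n G) → Fin (n G)
    involutive  : ∀ v → partner (partner v) ≡ v
    isEdge      : ∀ v → Adj G v (partner v)
open OneFactor public

inF : ∀ {G} → OneFactor G → Fin (n G) × Fin (n G) → Bool
inF F (a , b) = does (partner F a ≟ b)

FAlternating : ∀ {G} → OneFactor G → List (Fin (n G)) → Set
FAlternating F vs = length (cycEdges vs) ≡ 2 * countᵇ (inF F) (cycEdges vs)

record Orientation (G : Graph) : Set where
  field
    dir   : Fin (n G) → Fin (n G) → Bool
    exact : ∀ {u v} → Adj G u v → dir u v ≡ not (dir v u)
open Orientation public

forwardCount : ∀ {G} → Orientation G → List (Fin (n G)) → ℕ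
forwardCount O vs = countᵇ (λ e → dir O (Data.Product.proj₁ e) (Data.Product.proj₂ e)) (cycEdges vs)

-- evenly oriented (for an even cycle the parity does not depend on the direction)
EvenlyOriented : ∀ {G} → Orientation G → List (Fin (n G)) → Set
EvenlyOriented O vs = Even (forwardCount O vs)

edgeOn : ∀ {k} → Fin k → Fin k → List (Fin k) → Bool
edgeOn u v vs = any (λ e → (does (Data.Product.proj₁ e ≟ u) ∧ does (Data.Product.proj₂ e ≟ v))
                         ∨ (does (Data.Product.proj₁ e ≟ v) ∧ does (Data.Product.proj₂ e ≟ u)))
                    (cycEdges vs)

ZeroSumFSet : ∀ {G} → OneFactor G → List (List (Fin (n G))) → Set
ZeroSumFSet {G} F 𝒜 =
  All (IsCycle G) 𝒜 × All (FAlternating F) 𝒜 ×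
  (∀ u v → Adj G u v → Even (countᵇ (edgeOn u v) 𝒜))

OddFSet : ∀ {G} → OneFactor G → List (List (Fin (n G))) → Set
OddFSet F 𝒜 = ZeroSumFSet F 𝒜 × Odd (length 𝒜)

SimplyBad : Graph → Set
SimplyBad G = Σ (OneFactor G) λ F → Σ (List (List (Fin (n G)))) λ 𝒜 →
  OddFSet F 𝒜 × Σ (Orientation G) λ O → All (EvenlyOriented O) 𝒜

-- H is (isomorphic to) the graph obtained from G by contracting the vertex set C
-- to a single vertex: φ : V(G) → V(H) is onto, identifies exactly the vertices
-- of C (and nothing else), and ab ∈ E(H) iff a ≠ b and some edge uv of G has
-- φ u = a, φ v = b.
IsContraction : (G : Graph) → List (Fin (n G)) → (H : Graph) → Set
IsContraction G C H = Σ (Fin (n G) → Fin (n H)) λ φ →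
  (∀ a → ∃[ u ] φ u ≡ a) ×
  (∀ u v → (φ u ≡ φ v) ⇔ (u ≡ v ⊎ (u ∈ C × v ∈ C))) ×
  (∀ a b → Adj H a b ⇔ (a ≢ b × ∃[ u ] ∃[ v ] (φ u ≡ a × φ v ≡ b × Adj G u v)))

SimplyReducible : Graph → Graph → Set
SimplyReducible G H = Σ (List (Fin (n G))) λ C →
  IsCycle G C × Odd (length C) × IsContraction G C H

-- Let C be the odd cycle contracted to the vertex c of H, let cw be the F-edge of H at c, and let
-- uw′ be an edge of G over it with u on C. Removing u from C leaves a path with an even number of
-- vertices; its perfect matching, together with uw′ and the F-edges of H away from c, is a 1-factor of
-- G. Orient G as H away from C and cyclically along C. A cycle of the odd F-set through c uses the
-- F-edge cw and one more edge cx; it lifts to G by replacing c with the path along C from a fixed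
-- C-neighbour of x to u which alternates with respect to the new 1-factor. Since C is odd, exactly one
-- of the two arcs works, and it has an even number of forward edges, so the lift stays alternating and
-- evenly oriented. The lifted family has the same odd number of members. An edge of G away from C, or
-- joining C to the rest, lies on as many lifts as the corresponding edge of H lies on cycles; an edge
-- of C lies on the lifts of the cycles through cx for the various x, and there are an even number of
-- those for each x.

module Submission where

open import Defs renaming (sym to Adj-sym)
open import Algebra.Bundles using (CommutativeRing)
import Algebra.Properties.CommutativeSemigroup as CommutativeSemigroupProperties
open import Data.Bool using (Bool; true; false; not; _∧_; _∨_; _xor_; if_then_else_)
import Data.Bool as Bool
open import Data.Bool.ListAction using (any)
open import Data.Bool.Properties
  using (∨-comm; ∨-assoc; ∧-comm; ∧-identityʳ; ∧-zeroʳ; ∨-identityʳ; ∨-zeroʳ; not-involutive; not-distribˡ-xor; not-distribʳ-xor;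
         xor-same; xor-identityʳ; xor-∧-commutativeRing)
open import Data.Empty using (⊥; ⊥-elim)
open import Data.Fin using (Fin; _≟_)
open import Data.List using (List; []; _∷_; _++_; length; map; reverse; _∷ʳ_; allFin)
open import Data.List.Properties
  using (++-assoc; ++-identityʳ; reverse-++; unfold-reverse; map-++; length-++; length-map; length-reverse; ∷-injectiveˡ; ∷-injectiveʳ)
open import Data.List.Membership.Propositional using (_∈_; _∉_)
open import Data.List.Membership.Propositional.Properties using (∈-∃++; ∈-++⁺ʳ; ∈-map⁻; ∈-allFin)
import Data.List.Membership.DecPropositional as DecMembership
open import Data.List.Relation.Unary.All using (All; []; _∷_; lookupAny)
import Data.List.Relation.Unary.All as All
open import Data.List.Relation.Unary.All.Properties using (++⁺; ++⁻ˡ; ++⁻ʳ; map⁺)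
open import Data.List.Relation.Unary.AllPairs using ([]; _∷_)
import Data.List.Relation.Unary.AllPairs as AllPairs
open import Data.List.Relation.Unary.Any using (Any; here; there; any?)
import Data.List.Relation.Unary.Any as Any
open import Data.List.Relation.Unary.Unique.Propositional using (Unique)
open import Data.List.Relation.Unary.Unique.Propositional.Properties
  using (Unique[x∷xs]⇒x∉xs; allFin⁺) renaming (map⁺ to Unique-map⁺; ++⁺ to Unique-++⁺)
open import Data.List.Relation.Binary.Pointwise using (Pointwise; []; _∷_; Pointwise-length)
open import Data.List.Relation.Binary.Permutation.Propositional
  using (_↭_; prep; ↭-sym; ↭⇒↭ₛ) renaming (refl to ↭-refl; trans to ↭-trans; swap to ↭-swap)
open import Data.List.Relation.Binary.Permutation.Propositional.Properties
  using (All-resp-↭; Any-resp-↭; ↭-length; ↭-reverse; ∷↭∷ʳ; ++-comm; shift)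
import Data.List.Relation.Binary.Permutation.Setoid.Properties as SetoidPermutation
open import Data.Nat using (ℕ; zero; suc; _+_; _*_; _%_; _≤_; z≤n; s≤s; _<ᵇ_)
open import Data.Nat.DivMod using ([m+n]%n≡m%n)
open import Data.Nat.Properties using (+-assoc; +-comm; +-suc; +-identityʳ; +-mono-≤; suc-injective; m≤n⇒m≤1+n; 1+n≰n)
open import Data.Nat.Solver using (module +-*-Solver)
open import Data.Product using (Σ; _×_; _,_; proj₁; proj₂; ∃-syntax; swap)
import Data.Product as Product
open import Data.Sum using (_⊎_; inj₁; inj₂)
open import Function using (_∘_)
open import Function.Bundles using (_⇔_; Equivalence; mk⇔)
open import Relation.Nullary using (¬_; Dec; does; yes; no)
open import Relation.Nullary.Decidable using (dec-true; dec-false; does-⇔)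
open import Relation.Binary.PropositionalEquality using (_≡_; _≢_; refl; sym; trans; cong; cong₂; subst; subst₂; setoid; module ≡-Reasoning)
open +-*-Solver using (solve; _:+_; _:*_; con; _:=_)

private variable
  A B : Set

-- Counting and parity

𝟙 : Bool → ℕ
𝟙 b = if b then 1 else 0

countᵇ-++ : (p : A → Bool) (xs ys : List A) → countᵇ p (xs ++ ys) ≡ countᵇ p xs + countᵇ p ys
countᵇ-++ p [] ys = refl
countᵇ-++ p (x ∷ xs) ys = trans (cong (𝟙 (p x) +_) (countᵇ-++ p xs ys)) (sym (+-assoc (𝟙 (p x)) _ _))

countᵇ-map : (p : B → Bool) (f : A → B) (xs : List A) → countᵇ p (map f xs) ≡ countᵇ (p ∘ f) xs
countᵇ-map p f [] = refl
countᵇ-map p f (x ∷ xs) = cong (𝟙 (p (f x)) +_) (countᵇ-map p f xs)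

countᵇ-cong : {p q : A → Bool} {xs : List A} → All (λ x → p x ≡ q x) xs → countᵇ p xs ≡ countᵇ q xs
countᵇ-cong [] = refl
countᵇ-cong (e ∷ es) = cong₂ (λ b n → 𝟙 b + n) e (countᵇ-cong es)

countᵇ-↭ : (p : A → Bool) {xs ys : List A} → xs ↭ ys → countᵇ p xs ≡ countᵇ p ys
countᵇ-↭ p ↭-refl = refl
countᵇ-↭ p (prep x r) = cong (𝟙 (p x) +_) (countᵇ-↭ p r)
countᵇ-↭ p (↭-swap x y r) = begin
  𝟙 (p x) + (𝟙 (p y) + _)  ≡⟨ sym (+-assoc (𝟙 (p x)) _ _) ⟩
  (𝟙 (p x) + 𝟙 (p y)) + _  ≡⟨ cong₂ _+_ (+-comm (𝟙 (p x)) _) (countᵇ-↭ p r) ⟩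
  (𝟙 (p y) + 𝟙 (p x)) + _  ≡⟨ +-assoc (𝟙 (p y)) _ _ ⟩
  𝟙 (p y) + (𝟙 (p x) + _)  ∎
  where open ≡-Reasoning
countᵇ-↭ p (↭-trans r s) = trans (countᵇ-↭ p r) (countᵇ-↭ p s)

countᵇ-complement : {p q : A → Bool} {xs : List A} → All (λ x → q x ≡ not (p x)) xs →
  countᵇ p xs + countᵇ q xs ≡ length xs
countᵇ-complement [] = refl
countᵇ-complement {p = p} {q} {x ∷ xs} (e ∷ es) with p x | q x | e
... | true  | .false | refl = cong suc (countᵇ-complement es)
... | false | .true  | refl = trans (+-suc _ _) (cong suc (countᵇ-complement es))

countᵇ-all : {p : A → Bool} {xs : List A} → All (λ x → p x ≡ true) xs → countᵇ p xs ≡ length xs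
countᵇ-all [] = refl
countᵇ-all (e ∷ es) rewrite e = cong suc (countᵇ-all es)

countᵇ-none : {p : A → Bool} {xs : List A} → All (λ x → p x ≡ false) xs → countᵇ p xs ≡ 0
countᵇ-none [] = refl
countᵇ-none (e ∷ es) rewrite e = countᵇ-none es

any-++ : (p : A → Bool) (xs ys : List A) → any p (xs ++ ys) ≡ any p xs ∨ any p ys
any-++ p [] ys = refl
any-++ p (x ∷ xs) ys = trans (cong (p x ∨_) (any-++ p xs ys)) (sym (∨-assoc (p x) _ _))

any-map : (p : B → Bool) (f : A → B) (xs : List A) → any p (map f xs) ≡ any (p ∘ f) xs
any-map p f [] = refl
any-map p f (x ∷ xs) = cong (p (f x) ∨_) (any-map p f xs)

any-cong : {p q : A → Bool} {xs : List A} → All (λ x → p x ≡ q x) xs → any p xs ≡ any q xs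
any-cong [] = refl
any-cong (e ∷ es) = cong₂ _∨_ e (any-cong es)

any-↭ : (p : A → Bool) {xs ys : List A} → xs ↭ ys → any p xs ≡ any p ys
any-↭ p ↭-refl = refl
any-↭ p (prep x r) = cong (p x ∨_) (any-↭ p r)
any-↭ p (↭-swap x y r) = begin
  p x ∨ (p y ∨ _)  ≡⟨ sym (∨-assoc (p x) _ _) ⟩
  (p x ∨ p y) ∨ _  ≡⟨ cong₂ _∨_ (∨-comm (p x) (p y)) (any-↭ p r) ⟩
  (p y ∨ p x) ∨ _  ≡⟨ ∨-assoc (p y) _ _ ⟩
  p y ∨ (p x ∨ _)  ∎
  where open ≡-Reasoning
any-↭ p (↭-trans r s) = trans (any-↭ p r) (any-↭ p s)

any-none : {p : A → Bool} {xs : List A} → All (λ x → p x ≡ false) xs → any p xs ≡ false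
any-none [] = refl
any-none (e ∷ es) rewrite e = any-none es

any⇒∃ : (p : A → Bool) (xs : List A) → any p xs ≡ true → Σ A λ x → x ∈ xs × p x ≡ true
any⇒∃ p (x ∷ xs) h with p x in eq
... | true  = x , here refl , eq
... | false with any⇒∃ p xs h
...   | y , y∈xs , py = y , there y∈xs , py

¬any⇒countᵇ≡0 : (p : A → Bool) (xs : List A) → any p xs ≡ false → countᵇ p xs ≡ 0
¬any⇒countᵇ≡0 p [] h = refl
¬any⇒countᵇ≡0 p (x ∷ xs) h with p x
¬any⇒countᵇ≡0 p (x ∷ xs) () | true
... | false = ¬any⇒countᵇ≡0 p xs h

oddᵇ : ℕ → Bool
oddᵇ zero = false
oddᵇ (suc n) = not (oddᵇ n)

oddᵇ-𝟙 : (b : Bool) → oddᵇ (𝟙 b) ≡ b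
oddᵇ-𝟙 true = refl
oddᵇ-𝟙 false = refl

%2≡𝟙∘oddᵇ : (n : ℕ) → n % 2 ≡ 𝟙 (oddᵇ n)
%2≡𝟙∘oddᵇ zero = refl
%2≡𝟙∘oddᵇ (suc zero) = refl
%2≡𝟙∘oddᵇ (suc (suc n)) = begin
  (2 + n) % 2                ≡⟨ cong (_% 2) (+-comm 2 n) ⟩
  (n + 2) % 2                ≡⟨ [m+n]%n≡m%n n 2 ⟩
  n % 2                      ≡⟨ %2≡𝟙∘oddᵇ n ⟩
  𝟙 (oddᵇ n)                 ≡⟨ cong 𝟙 (sym (not-involutive (oddᵇ n))) ⟩
  𝟙 (oddᵇ (suc (suc n)))     ∎
  where open ≡-Reasoning

Even⇒¬oddᵇ : {k : ℕ} → Even k → oddᵇ k ≡ false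
Even⇒¬oddᵇ {k} e with oddᵇ k | %2≡𝟙∘oddᵇ k
... | false | _ = refl
... | true  | q with trans (sym e) q
...   | ()

¬oddᵇ⇒Even : {k : ℕ} → oddᵇ k ≡ false → Even k
¬oddᵇ⇒Even {k} p = trans (%2≡𝟙∘oddᵇ k) (cong 𝟙 p)

Odd⇒oddᵇ : {k : ℕ} → Odd k → oddᵇ k ≡ true
Odd⇒oddᵇ {k} e with oddᵇ k | %2≡𝟙∘oddᵇ k
... | true  | _ = refl
... | false | q with trans (sym e) q
...   | ()

oddᵇ-+ : (m n : ℕ) → oddᵇ (m + n) ≡ oddᵇ m xor oddᵇ n
oddᵇ-+ zero n = refl
oddᵇ-+ (suc m) n = trans (cong not (oddᵇ-+ m n)) (not-distribˡ-xor (oddᵇ m) (oddᵇ n))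

oddᵇ-2* : (k : ℕ) → oddᵇ (2 * k) ≡ false
oddᵇ-2* k = begin
  oddᵇ (k + (k + 0))   ≡⟨ cong (λ m → oddᵇ (k + m)) (+-identityʳ k) ⟩
  oddᵇ (k + k)         ≡⟨ oddᵇ-+ k k ⟩
  oddᵇ k xor oddᵇ k    ≡⟨ xor-same (oddᵇ k) ⟩
  false                ∎
  where open ≡-Reasoning

xorSum : (A → Bool) → List A → Bool
xorSum f [] = false
xorSum f (x ∷ xs) = f x xor xorSum f xs

oddᵇ-countᵇ : (p : A → Bool) (xs : List A) → oddᵇ (countᵇ p xs) ≡ xorSum p xs
oddᵇ-countᵇ p [] = refl
oddᵇ-countᵇ p (x ∷ xs) =
  trans (oddᵇ-+ (𝟙 (p x)) (countᵇ p xs)) (cong₂ _xor_ (oddᵇ-𝟙 (p x)) (oddᵇ-countᵇ p xs))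

xorSum-none : {f : A → Bool} {xs : List A} → All (λ x → f x ≡ false) xs → xorSum f xs ≡ false
xorSum-none [] = refl
xorSum-none (e ∷ es) rewrite e = xorSum-none es

xorSum-cong : {f g : A → Bool} {xs : List A} → All (λ x → f x ≡ g x) xs → xorSum f xs ≡ xorSum g xs
xorSum-cong [] = refl
xorSum-cong (e ∷ es) = cong₂ _xor_ e (xorSum-cong es)

xorSum-xor : (f g : A → Bool) (xs : List A) → xorSum f xs xor xorSum g xs ≡ xorSum (λ x → f x xor g x) xs
xorSum-xor f g [] = refl
xorSum-xor f g (x ∷ xs) =
  trans (interchange (f x) (xorSum f xs) (g x) (xorSum g xs)) (cong ((f x xor g x) xor_) (xorSum-xor f g xs))
  where open CommutativeSemigroupProperties (CommutativeRing.+-commutativeSemigroup xor-∧-commutativeRing) using (interchange)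

xorSum-swap : (h : A → B → Bool) (xs : List A) (ys : List B) →
  xorSum (λ y → xorSum (λ x → h x y) xs) ys ≡ xorSum (λ x → xorSum (h x) ys) xs
xorSum-swap h xs [] = sym (xorSum-none {xs = xs} (All.tabulate (λ _ → refl)))
xorSum-swap h xs (y ∷ ys) =
  trans (cong (xorSum (λ x → h x y) xs xor_) (xorSum-swap h xs ys)) (xorSum-xor (λ x → h x y) (λ x → xorSum (h x) ys) xs)

xorSum-∧ʳ : (f : A → Bool) (b : Bool) (xs : List A) → xorSum (λ x → f x ∧ b) xs ≡ xorSum f xs ∧ b
xorSum-∧ʳ f true xs = trans (xorSum-cong {xs = xs} (All.tabulate (λ {x} _ → ∧-identityʳ (f x)))) (sym (∧-identityʳ _))
xorSum-∧ʳ f false xs = trans (xorSum-none {xs = xs} (All.tabulate (λ {x} _ → ∧-zeroʳ (f x)))) (sym (∧-zeroʳ _))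

xorSum-unique : {f : A → Bool} {xs : List A} {x₀ : A} → Unique xs → x₀ ∈ xs →
  (∀ x → x ≢ x₀ → f x ≡ false) → xorSum f xs ≡ f x₀
xorSum-unique {f = f} {x₀ = x₀} (x₀∉xs ∷ _) (here refl) h =
  trans (cong (f x₀ xor_) (xorSum-none (All.map (λ {x} x₀≢x → h x (x₀≢x ∘ sym)) x₀∉xs))) (xor-identityʳ (f x₀))
xorSum-unique {f = f} {xs = x ∷ xs} (x∉xs ∷ u) (there x₀∈xs) h =
  trans (cong (_xor xorSum f xs) (h x (All.lookup x∉xs x₀∈xs))) (xorSum-unique u x₀∈xs h)

module _ {R : A → B → Set} where

  Pointwise-countᵇ : {f : A → Bool} {g : B → Bool} → (∀ {x y} → R x y → f x ≡ g y) →
    {xs : List A} {ys : List B} → Pointwise R xs ys → countᵇ f xs ≡ countᵇ g ys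
  Pointwise-countᵇ f≈g [] = refl
  Pointwise-countᵇ f≈g (r ∷ rs) = cong₂ (λ b n → 𝟙 b + n) (f≈g r) (Pointwise-countᵇ f≈g rs)

  Pointwise-xorSum : {f : A → Bool} {g : B → Bool} → (∀ {x y} → R x y → f x ≡ g y) →
    {xs : List A} {ys : List B} → Pointwise R xs ys → xorSum f xs ≡ xorSum g ys
  Pointwise-xorSum f≈g [] = refl
  Pointwise-xorSum f≈g (r ∷ rs) = cong₂ _xor_ (f≈g r) (Pointwise-xorSum f≈g rs)

  Pointwise-All : {P : A → Set} → (∀ {x y} → R x y → P x) → {xs : List A} {ys : List B} → Pointwise R xs ys → All P xs
  Pointwise-All R⇒P [] = []
  Pointwise-All R⇒P (r ∷ rs) = R⇒P r ∷ Pointwise-All R⇒P rs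

  All-Σ⇒Pointwise : {ys : List B} → All (λ y → Σ A λ x → R x y) ys → Σ (List A) λ xs → Pointwise R xs ys
  All-Σ⇒Pointwise [] = [] , []
  All-Σ⇒Pointwise ((x , r) ∷ rs) with All-Σ⇒Pointwise rs
  ... | xs , rs′ = x ∷ xs , r ∷ rs′

-- Vertex lists as paths and cycles

lastOf : A → List A → A
lastOf x [] = x
lastOf x (y ∷ ys) = lastOf y ys

lastOf-∈ : (x y : A) (ys : List A) → lastOf x (y ∷ ys) ∈ y ∷ ys
lastOf-∈ x y [] = here refl
lastOf-∈ x y (y′ ∷ ys) = there (lastOf-∈ y y′ ys)

lastOf-++ : (x : A) (xs : List A) (y : A) (ys : List A) → lastOf x (xs ++ y ∷ ys) ≡ lastOf y ys
lastOf-++ x [] y ys = refl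
lastOf-++ x (x′ ∷ xs) y ys = lastOf-++ x′ xs y ys

lastOf-map : (f : A → B) (x : A) (xs : List A) → lastOf (f x) (map f xs) ≡ f (lastOf x xs)
lastOf-map f x [] = refl
lastOf-map f x (y ∷ xs) = lastOf-map f y xs

pairs-++ : (x : A) (xs : List A) (y : A) (ys : List A) →
  pairs (x ∷ xs ++ y ∷ ys) ≡ pairs (x ∷ xs) ++ (lastOf x xs , y) ∷ pairs (y ∷ ys)
pairs-++ x [] y ys = refl
pairs-++ x (x′ ∷ xs) y ys = cong ((x , x′) ∷_) (pairs-++ x′ xs y ys)

pairs-∷ʳ : (x : A) (xs : List A) (y : A) → pairs (x ∷ xs ∷ʳ y) ≡ pairs (x ∷ xs) ∷ʳ (lastOf x xs , y)
pairs-∷ʳ x xs y = pairs-++ x xs y []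

cycEdges-∷ : (x : A) (xs : List A) → cycEdges (x ∷ xs) ≡ pairs (x ∷ xs) ∷ʳ (lastOf x xs , x)
cycEdges-∷ x xs = pairs-∷ʳ x xs x

pairs-split : (xs : List A) (y : A) (ys : List A) → pairs (xs ++ y ∷ ys) ≡ pairs (xs ∷ʳ y) ++ pairs (y ∷ ys)
pairs-split [] y ys = refl
pairs-split (x ∷ xs) y ys = begin
  pairs (x ∷ xs ++ y ∷ ys)                                   ≡⟨ pairs-++ x xs y ys ⟩
  pairs (x ∷ xs) ++ (lastOf x xs , y) ∷ pairs (y ∷ ys)       ≡⟨ sym (++-assoc (pairs (x ∷ xs)) _ _) ⟩
  (pairs (x ∷ xs) ∷ʳ (lastOf x xs , y)) ++ pairs (y ∷ ys)    ≡⟨ cong (_++ pairs (y ∷ ys)) (sym (pairs-∷ʳ x xs y)) ⟩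
  pairs (x ∷ xs ∷ʳ y) ++ pairs (y ∷ ys)                      ∎
  where open ≡-Reasoning

pairs-map : (f : A → B) (xs : List A) → pairs (map f xs) ≡ map (Product.map f f) (pairs xs)
pairs-map f [] = refl
pairs-map f (x ∷ []) = refl
pairs-map f (x ∷ y ∷ xs) = cong ((f x , f y) ∷_) (pairs-map f (y ∷ xs))

cycEdges-map : (f : A → B) (xs : List A) → cycEdges (map f xs) ≡ map (Product.map f f) (cycEdges xs)
cycEdges-map f [] = refl
cycEdges-map f (x ∷ xs) = trans (cong (λ ys → pairs (f x ∷ ys)) (sym (map-++ f xs (x ∷ [])))) (pairs-map f (x ∷ xs ∷ʳ x))

length-pairs : (x : A) (xs : List A) → length (pairs (x ∷ xs)) ≡ length xs
length-pairs x [] = refl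
length-pairs x (y ∷ xs) = cong suc (length-pairs y xs)

pairs-reverse : (xs : List A) → pairs (reverse xs) ≡ reverse (map swap (pairs xs))
pairs-reverse [] = refl
pairs-reverse (x ∷ []) = refl
pairs-reverse (x ∷ y ∷ xs) = begin
  pairs (reverse (x ∷ y ∷ xs))                          ≡⟨ cong pairs (trans (unfold-reverse x (y ∷ xs)) (cong (_∷ʳ x) (unfold-reverse y xs))) ⟩
  pairs ((reverse xs ∷ʳ y) ∷ʳ x)                        ≡⟨ cong pairs (++-assoc (reverse xs) (y ∷ []) (x ∷ [])) ⟩
  pairs (reverse xs ++ y ∷ x ∷ [])                      ≡⟨ pairs-split (reverse xs) y (x ∷ []) ⟩
  pairs (reverse xs ∷ʳ y) ∷ʳ (y , x)                    ≡⟨ cong (λ ys → pairs ys ∷ʳ (y , x)) (sym (unfold-reverse y xs)) ⟩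
  pairs (reverse (y ∷ xs)) ∷ʳ (y , x)                   ≡⟨ cong (_∷ʳ (y , x)) (pairs-reverse (y ∷ xs)) ⟩
  reverse (map swap (pairs (y ∷ xs))) ∷ʳ (y , x)        ≡⟨ sym (unfold-reverse (y , x) (map swap (pairs (y ∷ xs)))) ⟩
  reverse (map swap (pairs (x ∷ y ∷ xs)))               ∎
  where open ≡-Reasoning

pairs-All : {P : A → Set} {xs : List A} → All P xs → All (λ e → P (proj₁ e) × P (proj₂ e)) (pairs xs)
pairs-All [] = []
pairs-All (px ∷ []) = []
pairs-All (px ∷ py ∷ pxs) = (px , py) ∷ pairs-All (py ∷ pxs)

cycEdges-All : {P : A → Set} {xs : List A} → All P xs → All (λ e → P (proj₁ e) × P (proj₂ e)) (cycEdges xs)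
cycEdges-All {xs = []} [] = []
cycEdges-All {xs = x ∷ xs} (px ∷ pxs) = pairs-All (px ∷ ++⁺ pxs (px ∷ []))

pairs-∈ : (xs : List A) → All (λ e → proj₁ e ∈ xs × proj₂ e ∈ xs) (pairs xs)
pairs-∈ xs = pairs-All (All.tabulate (λ m → m))

cycEdges-rotate₁ : (x : A) (xs : List A) → cycEdges (x ∷ xs) ↭ cycEdges (xs ∷ʳ x)
cycEdges-rotate₁ x [] = ↭-refl
cycEdges-rotate₁ x (y ∷ ys) = subst₂ _↭_ (sym left) (sym right) (∷↭∷ʳ (x , y) middle)
  where
  middle = pairs (y ∷ ys) ∷ʳ (lastOf y ys , x)
  left : cycEdges (x ∷ y ∷ ys) ≡ (x , y) ∷ middle
  left = cong ((x , y) ∷_) (pairs-∷ʳ y ys x)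
  right : cycEdges (y ∷ ys ∷ʳ x) ≡ middle ∷ʳ (x , y)
  right = trans (cycEdges-∷ y (ys ∷ʳ x))
                (cong₂ (λ zs z → zs ∷ʳ (z , y)) (pairs-∷ʳ y ys x) (lastOf-++ y ys x []))

cycEdges-rotate : (xs : List A) (y : A) (ys : List A) → cycEdges (xs ++ y ∷ ys) ↭ cycEdges (y ∷ ys ++ xs)
cycEdges-rotate [] y ys = subst (λ zs → cycEdges (y ∷ ys) ↭ cycEdges (y ∷ zs)) (sym (++-identityʳ ys)) ↭-refl
cycEdges-rotate (x ∷ xs) y ys = ↭-trans (cycEdges-rotate₁ x (xs ++ y ∷ ys)) (subst₂ _↭_ lhs rhs (cycEdges-rotate xs y (ys ∷ʳ x)))
  where
  lhs : cycEdges (xs ++ y ∷ ys ∷ʳ x) ≡ cycEdges ((xs ++ y ∷ ys) ∷ʳ x)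
  lhs = cong cycEdges (sym (++-assoc xs (y ∷ ys) (x ∷ [])))
  rhs : cycEdges (y ∷ (ys ∷ʳ x) ++ xs) ≡ cycEdges (y ∷ ys ++ x ∷ xs)
  rhs = cong (λ zs → cycEdges (y ∷ zs)) (++-assoc ys (x ∷ []) xs)

rotate-↭ : (xs : List A) (y : A) (ys : List A) → xs ++ y ∷ ys ↭ y ∷ ys ++ xs
rotate-↭ xs y ys = ↭-trans (shift y xs ys) (prep y (++-comm xs ys))

cycReverse : List A → List A
cycReverse [] = []
cycReverse (x ∷ xs) = x ∷ reverse xs

cycEdges-cycReverse : (xs : List A) → cycEdges (cycReverse xs) ≡ reverse (map swap (cycEdges xs))
cycEdges-cycReverse [] = refl
cycEdges-cycReverse (x ∷ xs) = trans (cong pairs reversed) (pairs-reverse (x ∷ xs ∷ʳ x))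
  where
  reversed : x ∷ reverse xs ∷ʳ x ≡ reverse (x ∷ xs ∷ʳ x)
  reversed = sym (trans (unfold-reverse x (xs ∷ʳ x)) (cong (_∷ʳ x) (reverse-++ xs (x ∷ []))))

cycReverse-↭ : (xs : List A) → cycReverse xs ↭ xs
cycReverse-↭ [] = ↭-refl
cycReverse-↭ (x ∷ xs) = prep x (↭-reverse xs)

Unique-↭ : {xs ys : List A} → xs ↭ ys → Unique xs → Unique ys
Unique-↭ {A} p = SetoidPermutation.Unique-resp-↭ (setoid A) (↭⇒↭ₛ p)

Unique-++⁻ˡ : (xs : List A) {ys : List A} → Unique (xs ++ ys) → Unique xs
Unique-++⁻ˡ [] u = []
Unique-++⁻ˡ (x ∷ xs) (x∉ ∷ u) = ++⁻ˡ xs x∉ ∷ Unique-++⁻ˡ xs u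

Unique-++⁻ʳ : (xs : List A) {ys : List A} → Unique (xs ++ ys) → Unique ys
Unique-++⁻ʳ [] u = u
Unique-++⁻ʳ (x ∷ xs) (_ ∷ u) = Unique-++⁻ʳ xs u

reverse-∷ : (x : A) (xs : List A) → Σ (List A) λ ys → reverse (x ∷ xs) ≡ lastOf x xs ∷ ys
reverse-∷ x [] = [] , refl
reverse-∷ x (y ∷ xs) with reverse-∷ y xs
... | ys , eq = ys ∷ʳ x , trans (unfold-reverse x (y ∷ xs)) (cong (_∷ʳ x) eq)

pairs-All-tail : {P : A × A → Set} (x : A) (xs : List A) → All P (pairs (x ∷ xs)) → All P (pairs xs)
pairs-All-tail x [] _ = []
pairs-All-tail x (y ∷ xs) (_ ∷ ps) = ps

-- Matchings along paths

module _ {k : ℕ} where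

  private
    V = Fin k

  does≡true⇒≡ : {a b : V} → does (a ≟ b) ≡ true → a ≡ b
  does≡true⇒≡ {a} {b} h with a ≟ b
  ... | yes a≡b = a≡b

  consecutiveMatching : List V → V → V
  consecutiveMatching (d₁ ∷ d₂ ∷ ds) a =
    if does (a ≟ d₁) then d₂ else if does (a ≟ d₂) then d₁ else consecutiveMatching ds a
  consecutiveMatching _ a = a

  module _ (d₁ d₂ : V) (ds : List V) where

    consecutiveMatching-first : consecutiveMatching (d₁ ∷ d₂ ∷ ds) d₁ ≡ d₂
    consecutiveMatching-first rewrite dec-true (d₁ ≟ d₁) refl = refl

    consecutiveMatching-second : d₁ ≢ d₂ → consecutiveMatching (d₁ ∷ d₂ ∷ ds) d₂ ≡ d₁
    consecutiveMatching-second d₁≢d₂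
      rewrite dec-false (d₂ ≟ d₁) (d₁≢d₂ ∘ sym) | dec-true (d₂ ≟ d₂) refl = refl

    consecutiveMatching-rest : (a : V) → a ≢ d₁ → a ≢ d₂ →
      consecutiveMatching (d₁ ∷ d₂ ∷ ds) a ≡ consecutiveMatching ds a
    consecutiveMatching-rest a a≢d₁ a≢d₂ rewrite dec-false (a ≟ d₁) a≢d₁ | dec-false (a ≟ d₂) a≢d₂ = refl

  record MatchedIn (ds : List V) (a : V) : Set where
    field
      partner∈  : consecutiveMatching ds a ∈ ds
      involutive : consecutiveMatching ds (consecutiveMatching ds a) ≡ a

  consecutiveMatching-matched : (ds : List V) → Unique ds → oddᵇ (length ds) ≡ false →
    ∀ {a} → a ∈ ds → MatchedIn ds a
  consecutiveMatching-matched (d₁ ∷ d₂ ∷ ds) ((d₁≢d₂ ∷ _) ∷ _) _ (here refl) = record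
    { partner∈ = subst (_∈ d₁ ∷ d₂ ∷ ds) (sym (consecutiveMatching-first d₁ d₂ ds)) (there (here refl))
    ; involutive = trans (cong (consecutiveMatching (d₁ ∷ d₂ ∷ ds)) (consecutiveMatching-first d₁ d₂ ds))
                         (consecutiveMatching-second d₁ d₂ ds d₁≢d₂)
    }
  consecutiveMatching-matched (d₁ ∷ d₂ ∷ ds) ((d₁≢d₂ ∷ _) ∷ _) _ (there (here refl)) = record
    { partner∈ = subst (_∈ d₁ ∷ d₂ ∷ ds) (sym (consecutiveMatching-second d₁ d₂ ds d₁≢d₂)) (here refl)
    ; involutive = trans (cong (consecutiveMatching (d₁ ∷ d₂ ∷ ds)) (consecutiveMatching-second d₁ d₂ ds d₁≢d₂))
                         (consecutiveMatching-first d₁ d₂ ds)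
    }
  consecutiveMatching-matched (d₁ ∷ d₂ ∷ ds) ((_ ∷ d₁∉ds) ∷ d₂∉ds ∷ u) even {a} (there (there a∈ds)) = record
    { partner∈ = subst (_∈ d₁ ∷ d₂ ∷ ds) (sym (skip a∈ds)) (there (there (MatchedIn.partner∈ ih)))
    ; involutive = trans (cong (consecutiveMatching (d₁ ∷ d₂ ∷ ds)) (skip a∈ds))
                         (trans (skip (MatchedIn.partner∈ ih)) (MatchedIn.involutive ih))
    }
    where
    ih : MatchedIn ds a
    ih = consecutiveMatching-matched ds u (trans (sym (not-involutive _)) even) a∈ds
    skip : ∀ {b} → b ∈ ds → consecutiveMatching (d₁ ∷ d₂ ∷ ds) b ≡ consecutiveMatching ds b
    skip b∈ds = consecutiveMatching-rest d₁ d₂ ds _ (λ b≡d₁ → All.lookup d₁∉ds b∈ds (sym b≡d₁))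
                                                   (λ b≡d₂ → All.lookup d₂∉ds b∈ds (sym b≡d₂))

  consecutiveMatching-along : {R : V → V → Set} → (∀ {a b} → R a b → R b a) →
    (ds : List V) → Unique ds → oddᵇ (length ds) ≡ false →
    All (λ e → R (proj₁ e) (proj₂ e)) (pairs ds) → ∀ {a} → a ∈ ds → R a (consecutiveMatching ds a)
  consecutiveMatching-along {R} R-sym (d₁ ∷ d₂ ∷ ds) ((d₁≢d₂ ∷ _) ∷ _) _ (r ∷ _) (here refl) =
    subst (R d₁) (sym (consecutiveMatching-first d₁ d₂ ds)) r
  consecutiveMatching-along {R} R-sym (d₁ ∷ d₂ ∷ ds) ((d₁≢d₂ ∷ _) ∷ _) _ (r ∷ _) (there (here refl)) =
    subst (R d₂) (sym (consecutiveMatching-second d₁ d₂ ds d₁≢d₂)) (R-sym r)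
  consecutiveMatching-along {R} R-sym (d₁ ∷ d₂ ∷ ds) ((_ ∷ d₁∉ds) ∷ d₂∉ds ∷ u) even (_ ∷ rs) {a} (there (there a∈ds)) =
    subst (R a) (sym (consecutiveMatching-rest d₁ d₂ ds a (λ a≡d₁ → All.lookup d₁∉ds a∈ds (sym a≡d₁))
                                                          (λ a≡d₂ → All.lookup d₂∉ds a∈ds (sym a≡d₂))))
      (consecutiveMatching-along R-sym ds u (trans (sym (not-involutive _)) even) (tail d₂ ds rs) a∈ds)
    where
    tail : ∀ {P : V × V → Set} x xs → All P (pairs (x ∷ xs)) → All P (pairs xs)
    tail x [] _ = []
    tail x (y ∷ xs) (_ ∷ ps) = ps

  matches : (V → V) → V × V → Bool
  matches f (a , b) = does (f a ≟ b)

  -- The consecutive pairs of xs alternate between matched and unmatched by f, the first one being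
  -- matched iff b.
  data Alternating (f : V → V) : Bool → List V → Set where
    []  : ∀ {b} → Alternating f b []
    [_] : ∀ {b} x → Alternating f b (x ∷ [])
    _∷_ : ∀ {b x y ys} → matches f (x , y) ≡ b → Alternating f (not b) (y ∷ ys) → Alternating f b (x ∷ y ∷ ys)

  Alternating-cong : ∀ {f g b} (xs : List V) → (∀ {a} → a ∈ xs → f a ≡ g a) → Alternating f b xs → Alternating g b xs
  Alternating-cong [] f≗g [] = []
  Alternating-cong (x ∷ []) f≗g [ x ] = [ x ]
  Alternating-cong (x ∷ y ∷ xs) f≗g (m ∷ alt) =
    trans (cong (λ a → does (a ≟ y)) (sym (f≗g (here refl)))) m ∷ Alternating-cong (y ∷ xs) (f≗g ∘ there) alt

  Alternating-drop : ∀ {f b} (xs : List V) {ys : List V} → Alternating f b (xs ++ ys) →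
    Alternating f (oddᵇ (length xs) xor b) ys
  Alternating-drop [] alt = alt
  Alternating-drop {f} {b} (x ∷ xs) {ys} alt =
    subst (λ c → Alternating f c ys) (trans (sym (not-distribʳ-xor ℓ b)) (not-distribˡ-xor ℓ b)) (Alternating-drop xs (tail alt))
    where
    ℓ = oddᵇ (length xs)
    tail : ∀ {c z zs} → Alternating f c (z ∷ zs) → Alternating f (not c) zs
    tail [ _ ] = []
    tail (_ ∷ alt′) = alt′

  Alternating-take : ∀ {f b} (xs : List V) (y : V) (ys : List V) → Alternating f b (xs ++ y ∷ ys) → Alternating f b (xs ∷ʳ y)
  Alternating-take [] y ys alt = [ y ]
  Alternating-take (x ∷ []) y ys (m ∷ alt) = m ∷ [ y ]
  Alternating-take (x ∷ x′ ∷ xs) y ys (m ∷ alt) = m ∷ Alternating-take (x′ ∷ xs) y ys alt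

  Alternating-countᵇ : ∀ {f b} (x : V) (xs : List V) → Alternating f b (x ∷ xs) → oddᵇ (length xs) ≡ b →
    countᵇ (matches f) (pairs (x ∷ xs)) + countᵇ (matches f) (pairs (x ∷ xs)) ≡ 𝟙 b + length xs
  Alternating-countᵇ x [] [ x ] refl = refl
  Alternating-countᵇ {f} {true} x (y ∷ ys) (m ∷ alt) odd rewrite m =
    cong suc (trans (+-suc c c) (cong suc (Alternating-countᵇ y ys alt (trans (sym (not-involutive _)) (cong not odd)))))
    where c = countᵇ (matches f) (pairs (y ∷ ys))
  Alternating-countᵇ {f} {false} x (y ∷ ys) (m ∷ alt) odd rewrite m =
    Alternating-countᵇ y ys alt (trans (sym (not-involutive _)) (cong not odd))

  consecutiveMatching-alternating : (ds : List V) → Unique ds → oddᵇ (length ds) ≡ false →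
    Alternating (consecutiveMatching ds) true ds
  consecutiveMatching-alternating [] _ _ = []
  consecutiveMatching-alternating (d₁ ∷ d₂ ∷ ds) ((d₁≢d₂ ∷ d₁∉ds) ∷ d₂∉ds ∷ u) even =
    trans (cong (λ a → does (a ≟ d₂)) (consecutiveMatching-first d₁ d₂ ds)) (dec-true (d₂ ≟ d₂) refl) ∷ rest ds refl
    where
    M = consecutiveMatching (d₁ ∷ d₂ ∷ ds)
    rest : (ds′ : List V) → ds′ ≡ ds → Alternating M false (d₂ ∷ ds′)
    rest [] _ = [ d₂ ]
    rest (d₃ ∷ ds′) refl =
      trans (cong (λ a → does (a ≟ d₃)) (consecutiveMatching-second d₁ d₂ ds d₁≢d₂)) (dec-false (d₁ ≟ d₃) (All.lookup d₁∉ds (here refl)))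
      ∷ Alternating-cong ds (λ {a} a∈ds → sym (consecutiveMatching-rest d₁ d₂ ds a (λ a≡d₁ → All.lookup d₁∉ds a∈ds (sym a≡d₁))
                                                                                    (λ a≡d₂ → All.lookup d₂∉ds a∈ds (sym a≡d₂))))
          (consecutiveMatching-alternating ds u (trans (sym (not-involutive _)) even))

  position : List V → V → ℕ
  position [] a = 0
  position (y ∷ ys) a = if does (a ≟ y) then 0 else suc (position ys a)

  position-here : (y : V) (ys : List V) → position (y ∷ ys) y ≡ 0
  position-here y ys rewrite dec-true (y ≟ y) refl = refl

  position-there : (y : V) (ys : List V) (a : V) → a ≢ y → position (y ∷ ys) a ≡ suc (position ys a)
  position-there y ys a a≢y rewrite dec-false (a ≟ y) a≢y = refl

  position-injective : (ys : List V) {a b : V} → a ∈ ys → b ∈ ys → position ys a ≡ position ys b → a ≡ b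
  position-injective (y ∷ ys) {a} {b} a∈ b∈ eq with a ≟ y | b ≟ y
  ... | yes a≡y | yes b≡y = trans a≡y (sym b≡y)
  position-injective (y ∷ ys) a∈ b∈ () | yes _ | no _
  position-injective (y ∷ ys) a∈ b∈ () | no _ | yes _
  ... | no a≢y | no b≢y = position-injective ys (tail a∈ a≢y) (tail b∈ b≢y) (suc-injective eq)
    where
    tail : ∀ {x} → x ∈ y ∷ ys → x ≢ y → x ∈ ys
    tail (here x≡y) x≢y = ⊥-elim (x≢y x≡y)
    tail (there x∈ys) _ = x∈ys

  position-pairs : (x : V) (xs : List V) → Unique (x ∷ xs) →
    All (λ e → position (x ∷ xs) (proj₂ e) ≡ suc (position (x ∷ xs) (proj₁ e))) (pairs (x ∷ xs))
  position-pairs x [] u = []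
  position-pairs x (y ∷ xs) (x∉@(x≢y ∷ _) ∷ u) =
    trans (position-there x (y ∷ xs) y (x≢y ∘ sym)) (cong suc (trans (position-here y xs) (sym (position-here x (y ∷ xs)))))
    ∷ All.map step (All.zip (position-pairs y xs u , pairs-All (All.map (_∘ sym) x∉)))
    where
    step : ∀ {e : V × V} → position (y ∷ xs) (proj₂ e) ≡ suc (position (y ∷ xs) (proj₁ e)) × (proj₁ e ≢ x × proj₂ e ≢ x) →
      position (x ∷ y ∷ xs) (proj₂ e) ≡ suc (position (x ∷ y ∷ xs) (proj₁ e))
    step {a , b} (eq , a≢x , b≢x) =
      trans (position-there x (y ∷ xs) b b≢x) (trans (cong suc eq) (cong suc (sym (position-there x (y ∷ xs) a a≢x))))

  breakAt : V → List V → List V × List V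
  breakAt v [] = [] , []
  breakAt v (y ∷ ys) = if does (v ≟ y) then ([] , ys) else (y ∷ proj₁ (breakAt v ys) , proj₂ (breakAt v ys))

  breakAt-++ : (v : V) (xs : List V) → v ∈ xs → xs ≡ proj₁ (breakAt v xs) ++ v ∷ proj₂ (breakAt v xs)
  breakAt-++ v (y ∷ ys) v∈ with v ≟ y
  ... | yes v≡y = cong (_∷ ys) (sym v≡y)
  breakAt-++ v (y ∷ ys) (here v≡y) | no v≢y = ⊥-elim (v≢y v≡y)
  breakAt-++ v (y ∷ ys) (there v∈ys) | no _ = cong (y ∷_) (breakAt-++ v ys v∈ys)

n<ᵇ1+n : (n : ℕ) → (n <ᵇ suc n) ≡ true
n<ᵇ1+n zero = refl
n<ᵇ1+n (suc n) = n<ᵇ1+n n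

1+n<ᵇn : (n : ℕ) → (suc n <ᵇ n) ≡ false
1+n<ᵇn zero = refl
1+n<ᵇn (suc n) = 1+n<ᵇn n

<ᵇ-asym : (m n : ℕ) → m ≢ n → (m <ᵇ n) ≡ not (n <ᵇ m)
<ᵇ-asym zero zero m≢n = ⊥-elim (m≢n refl)
<ᵇ-asym zero (suc n) _ = refl
<ᵇ-asym (suc m) zero _ = refl
<ᵇ-asym (suc m) (suc n) m≢n = <ᵇ-asym m n (m≢n ∘ cong suc)

-- Alternating, evenly oriented cycles

module _ {k : ℕ} where

  private
    V = Fin k

  -- The test used by edgeOn, so that edgeOn u v xs is any (joins u v) (cycEdges xs) by definition.
  joins : V → V → V × V → Bool
  joins u v e = (does (proj₁ e ≟ u) ∧ does (proj₂ e ≟ v)) ∨ (does (proj₁ e ≟ v) ∧ does (proj₂ e ≟ u))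

  joins-swap : (u v : V) (e : V × V) → joins u v (swap e) ≡ joins u v e
  joins-swap u v (a , b) =
    trans (∨-comm (does (b ≟ u) ∧ does (a ≟ v)) _) (cong₂ _∨_ (∧-comm (does (b ≟ v)) _) (∧-comm (does (b ≟ u)) _))

  joins-sym : (u v : V) (e : V × V) → joins u v e ≡ joins v u e
  joins-sym u v (a , b) = ∨-comm (does (a ≟ u) ∧ does (b ≟ v)) _

  joins⇒ : {u v : V} (e : V × V) → joins u v e ≡ true → (proj₁ e ≡ u × proj₂ e ≡ v) ⊎ (proj₁ e ≡ v × proj₂ e ≡ u)
  joins⇒ {u} {v} (a , b) h with a ≟ u | b ≟ v | a ≟ v | b ≟ u
  ... | yes a≡u | yes b≡v | _ | _ = inj₁ (a≡u , b≡v)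
  ... | _ | _ | yes a≡v | yes b≡u = inj₂ (a≡v , b≡u)
  joins⇒ _ () | no _ | _ | no _ | _
  joins⇒ _ () | no _ | _ | yes _ | no _
  joins⇒ _ () | yes _ | no _ | no _ | _
  joins⇒ _ () | yes _ | no _ | yes _ | no _

  joins-avoidsˡ : {u v a b : V} → a ≢ u → b ≢ u → joins u v (a , b) ≡ false
  joins-avoidsˡ {u} {v} {a} {b} a≢u b≢u rewrite dec-false (a ≟ u) a≢u | dec-false (b ≟ u) b≢u = ∧-zeroʳ (does (a ≟ v))

  joins-avoidsʳ : {u v a b : V} → a ≢ v → b ≢ v → joins u v (a , b) ≡ false
  joins-avoidsʳ {u} {v} {a} {b} a≢v b≢v = trans (joins-sym u v (a , b)) (joins-avoidsˡ {v = u} a≢v b≢v)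

  joins-avoids₁ : {u v a b : V} → a ≢ u → a ≢ v → joins u v (a , b) ≡ false
  joins-avoids₁ {u} {v} {a} {b} a≢u a≢v rewrite dec-false (a ≟ u) a≢u | dec-false (a ≟ v) a≢v = refl

  joins-avoids₂ : {u v a b : V} → b ≢ u → b ≢ v → joins u v (a , b) ≡ false
  joins-avoids₂ {u} {v} {a} {b} b≢u b≢v = trans (sym (joins-swap u v (a , b))) (joins-avoids₁ {b = a} b≢u b≢v)

  edgeOn-sym : (u v : V) (xs : List V) → edgeOn u v xs ≡ edgeOn v u xs
  edgeOn-sym u v xs = any-cong (All.tabulate {xs = cycEdges xs} (λ {e} _ → joins-sym u v e))

SameEdges : {k : ℕ} → List (Fin k) → List (Fin k) → Set
SameEdges N L = ∀ u v → edgeOn u v N ≡ edgeOn u v L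

module _ {K : Graph} where

  private
    V = Fin (n K)

  AdjPair : V × V → Set
  AdjPair e = Adj K (proj₁ e) (proj₂ e)

  edgeOn⇒Adj : (L : List V) → All AdjPair (cycEdges L) → {u v : V} → edgeOn u v L ≡ true → Adj K u v
  edgeOn⇒Adj L adj {u} {v} h with any⇒∃ (joins u v) (cycEdges L) h
  ... | e , e∈ , j with joins⇒ e j
  ...   | inj₁ (refl , refl) = All.lookup adj e∈
  ...   | inj₂ (refl , refl) = Adj-sym K (All.lookup adj e∈)

  inF-swap : (F : OneFactor K) (a b : V) → inF F (b , a) ≡ inF F (a , b)
  inF-swap F a b = does-⇔ (mk⇔ (flip b a) (flip a b)) (partner F b ≟ a) (partner F a ≟ b)
    where
    flip : ∀ x y → partner F x ≡ y → partner F y ≡ x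
    flip x y eq = trans (sym (cong (partner F) eq)) (involutive F x)

  -- A 1-factor cannot contain two consecutive edges of a path.
  countᵇ-inF-pairs : (F : OneFactor K) (xs : List V) → Unique xs →
    countᵇ (inF F) (pairs xs) + countᵇ (inF F) (pairs xs) ≤ suc (length (pairs xs))
  countᵇ-inF-pairs F [] u = z≤n
  countᵇ-inF-pairs F (x ∷ []) u = z≤n
  countᵇ-inF-pairs F (x ∷ y ∷ []) u with inF F (x , y)
  ... | true  = s≤s (s≤s z≤n)
  ... | false = z≤n
  countᵇ-inF-pairs F (x ∷ y ∷ z ∷ zs) ((_ ∷ x≢z ∷ _) ∷ u@(_ ∷ u′)) =
    step (countᵇ-inF-pairs F (y ∷ z ∷ zs) u) (countᵇ-inF-pairs F (z ∷ zs) u′)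
    where
    c = countᵇ (inF F) (pairs (z ∷ zs))
    c′ = countᵇ (inF F) (pairs (y ∷ z ∷ zs))
    step : c′ + c′ ≤ suc (length (pairs (y ∷ z ∷ zs))) → c + c ≤ suc (length (pairs (z ∷ zs))) →
      countᵇ (inF F) (pairs (x ∷ y ∷ z ∷ zs)) + countᵇ (inF F) (pairs (x ∷ y ∷ z ∷ zs)) ≤ suc (length (pairs (x ∷ y ∷ z ∷ zs)))
    step ih₁ ih₂ with inF F (x , y) in xy
    ... | false = m≤n⇒m≤1+n ih₁
    ... | true with inF F (y , z) in yz
    ...   | true = ⊥-elim (x≢z (trans (sym (involutive F x)) (trans (cong (partner F) (does≡true⇒≡ xy)) (does≡true⇒≡ yz))))
    ...   | false = s≤s (subst (_≤ suc (suc (length (pairs (z ∷ zs))))) (sym (+-suc c c)) (s≤s ih₂))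

  -- Half of the edges of an alternating cycle are F-edges, so the previous lemma forces an F-edge at each vertex.
  alternating-partner : (F : OneFactor K) (c t : V) (ts : List V) → Unique (c ∷ t ∷ ts) → FAlternating F (c ∷ t ∷ ts) →
    partner F c ≡ t ⊎ partner F c ≡ lastOf t ts
  alternating-partner F c t ts (_ ∷ u) alt = decide (partner F c ≟ t) (partner F c ≟ z)
    where
    z = lastOf t ts
    P = pairs (t ∷ ts)
    ℓ = length P
    m = countᵇ (inF F) P
    edges : cycEdges (c ∷ t ∷ ts) ≡ (c , t) ∷ (P ∷ʳ (z , c))
    edges = cong ((c , t) ∷_) (pairs-∷ʳ t ts c)
    length-edges : length (cycEdges (c ∷ t ∷ ts)) ≡ suc (suc ℓ)
    length-edges = trans (cong length edges) (cong suc (trans (length-++ P) (+-comm ℓ 1)))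
    decide : Dec (partner F c ≡ t) → Dec (partner F c ≡ z) → partner F c ≡ t ⊎ partner F c ≡ z
    decide (yes p≡t) _ = inj₁ p≡t
    decide (no _) (yes p≡z) = inj₂ p≡z
    decide (no p≢t) (no p≢z) = ⊥-elim (1+n≰n (subst (_≤ suc ℓ) (sym twice) (countᵇ-inF-pairs F (t ∷ ts) u)))
      where
      open ≡-Reasoning
      count : countᵇ (inF F) (cycEdges (c ∷ t ∷ ts)) ≡ m
      count = begin
        countᵇ (inF F) (cycEdges (c ∷ t ∷ ts))
          ≡⟨ cong (countᵇ (inF F)) edges ⟩
        𝟙 (inF F (c , t)) + countᵇ (inF F) (P ∷ʳ (z , c))
          ≡⟨ cong (λ b → 𝟙 b + countᵇ (inF F) (P ∷ʳ (z , c))) (dec-false (partner F c ≟ t) p≢t) ⟩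
        countᵇ (inF F) (P ∷ʳ (z , c))
          ≡⟨ countᵇ-++ (inF F) P _ ⟩
        m + (𝟙 (inF F (z , c)) + 0)
          ≡⟨ cong (λ b → m + (𝟙 b + 0)) (trans (inF-swap F c z) (dec-false (partner F c ≟ z) p≢z)) ⟩
        m + 0
          ≡⟨ +-identityʳ m ⟩
        m ∎
      twice : suc (suc ℓ) ≡ m + m
      twice = begin
        suc (suc ℓ)                                ≡⟨ sym length-edges ⟩
        length (cycEdges (c ∷ t ∷ ts))             ≡⟨ alt ⟩
        2 * countᵇ (inF F) (cycEdges (c ∷ t ∷ ts)) ≡⟨ cong (2 *_) count ⟩
        m + (m + 0)                                ≡⟨ cong (m +_) (+-identityʳ m) ⟩
        m + m                                      ∎

  forward : Orientation K → V × V → Bool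
  forward O (a , b) = dir O a b

  record EvenAlternatingCycle (F : OneFactor K) (O : Orientation K) (N : List V) : Set where
    field
      isCycle        : IsCycle K N
      alternating    : FAlternating F N
      evenlyOriented : EvenlyOriented O N

  module _ (F : OneFactor K) (O : Orientation K) {N L : List V} (N↭L : N ↭ L) where

    EvenAlternatingCycle-↭ : cycEdges N ↭ cycEdges L → EvenAlternatingCycle F O L → EvenAlternatingCycle F O N
    EvenAlternatingCycle-↭ EN↭EL good = record
      { isCycle = subst (3 ≤_) (sym (↭-length N↭L)) (proj₁ isCycle)
                , Unique-↭ (↭-sym N↭L) (proj₁ (proj₂ isCycle))
                , All-resp-↭ (↭-sym EN↭EL) (proj₂ (proj₂ isCycle))
      ; alternating = trans (↭-length EN↭EL) (trans alternating (cong (2 *_) (sym (countᵇ-↭ (inF F) EN↭EL))))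
      ; evenlyOriented = subst Even (sym (countᵇ-↭ (forward O) EN↭EL)) evenlyOriented
      }
      where open EvenAlternatingCycle good

    -- Reversing the traversal preserves even orientation because an alternating cycle has even length.
    EvenAlternatingCycle-reverse : cycEdges N ↭ map swap (cycEdges L) → EvenAlternatingCycle F O L → EvenAlternatingCycle F O N
    EvenAlternatingCycle-reverse EN↭rEL good = record
      { isCycle = subst (3 ≤_) (sym (↭-length N↭L)) (proj₁ isCycle)
                , Unique-↭ (↭-sym N↭L) (proj₁ (proj₂ isCycle))
                , All-resp-↭ (↭-sym EN↭rEL) (map⁺ (All.map (Adj-sym K) adj))
      ; alternating = trans (↭-length EN↭rEL) (trans (length-map swap EL) (trans alternating (cong (2 *_) (sym factorEdges))))
      ; evenlyOriented = ¬oddᵇ⇒Even {countᵇ (forward O) (cycEdges N)} (subst (λ m → oddᵇ m ≡ false) (sym backward) parity)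
      }
      where
      open EvenAlternatingCycle good
      EL = cycEdges L
      adj : All AdjPair EL
      adj = proj₂ (proj₂ isCycle)
      factorEdges : countᵇ (inF F) (cycEdges N) ≡ countᵇ (inF F) EL
      factorEdges = trans (countᵇ-↭ (inF F) EN↭rEL)
        (trans (countᵇ-map (inF F) swap EL) (countᵇ-cong (All.tabulate {xs = EL} (λ {e} _ → inF-swap F (proj₁ e) (proj₂ e)))))
      backward : countᵇ (forward O) (cycEdges N) ≡ countᵇ (forward O ∘ swap) EL
      backward = trans (countᵇ-↭ (forward O) EN↭rEL) (countᵇ-map (forward O) swap EL)
      complement : countᵇ (forward O) EL + countᵇ (forward O ∘ swap) EL ≡ length EL
      complement = countᵇ-complement (All.map (λ a → exact O (Adj-sym K a)) adj)
      f = countᵇ (forward O) EL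
      b = countᵇ (forward O ∘ swap) EL
      parity : oddᵇ (countᵇ (forward O ∘ swap) EL) ≡ false
      parity = begin
        oddᵇ (countᵇ (forward O ∘ swap) EL)                                   ≡⟨ cong (_xor oddᵇ b) (sym (Even⇒¬oddᵇ {f} evenlyOriented)) ⟩
        oddᵇ (countᵇ (forward O) EL) xor oddᵇ (countᵇ (forward O ∘ swap) EL)  ≡⟨ sym (oddᵇ-+ f b) ⟩
        oddᵇ (countᵇ (forward O) EL + countᵇ (forward O ∘ swap) EL)           ≡⟨ cong oddᵇ (trans complement alternating) ⟩
        oddᵇ (2 * countᵇ (inF F) EL)                                          ≡⟨ oddᵇ-2* (countᵇ (inF F) EL) ⟩
        false                                                                 ∎
        where open ≡-Reasoning

  SameEdges-↭ : {N L : List V} → cycEdges N ↭ cycEdges L → SameEdges N L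
  SameEdges-↭ EN↭EL u v = any-↭ (joins u v) EN↭EL

  SameEdges-reverse : {N L : List V} → cycEdges N ↭ map swap (cycEdges L) → SameEdges N L
  SameEdges-reverse {L = L} EN↭rEL u v =
    trans (any-↭ (joins u v) EN↭rEL)
          (trans (any-map (joins u v) swap (cycEdges L)) (any-cong (All.tabulate {xs = cycEdges L} (λ {e} _ → joins-swap u v e))))

  rotateToPartner : (F : OneFactor K) (O : Orientation K) (c : V) (L : List V) → EvenAlternatingCycle F O L → c ∈ L →
    Σ (List V) λ B → EvenAlternatingCycle F O (c ∷ partner F c ∷ B) × SameEdges (c ∷ partner F c ∷ B) L
  rotateToPartner F O c L good c∈L with ∈-∃++ c∈L
  ... | P , S , refl = orient (S ++ P) (EvenAlternatingCycle-↭ F O (↭-sym (rotate-↭ P c S)) rotated good , SameEdges-↭ {L = P ++ c ∷ S} rotated)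
    where
    rotated = ↭-sym (cycEdges-rotate P c S)
    Result : List V → Set
    Result N = EvenAlternatingCycle F O N × SameEdges N (P ++ c ∷ S)
    orient : (T : List V) → Result (c ∷ T) → Σ (List V) λ B → Result (c ∷ partner F c ∷ B)
    orient [] (good′ , _) with proj₁ (EvenAlternatingCycle.isCycle good′)
    ... | s≤s ()
    orient (t ∷ ts) (good′ , same) with alternating-partner F c t ts (proj₁ (proj₂ isCycle)) alternating
      where open EvenAlternatingCycle good′
    ... | inj₁ p≡t = ts , subst (λ x → Result (c ∷ x ∷ ts)) (sym p≡t) (good′ , same)
    ... | inj₂ p≡z with reverse-∷ t ts
    ...   | B , rev = B , subst (λ x → Result (c ∷ x ∷ B)) (sym p≡z) (subst (λ N → Result (c ∷ N)) rev
                            (EvenAlternatingCycle-reverse F O (cycReverse-↭ M) reversed good′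
                            , λ u v → trans (SameEdges-reverse {L = M} reversed u v) (same u v)))
      where
      M = c ∷ t ∷ ts
      reversed : cycEdges (cycReverse M) ↭ map swap (cycEdges M)
      reversed = subst (_↭ map swap (cycEdges M)) (sym (cycEdges-cycReverse M)) (↭-reverse (map swap (cycEdges M)))

edgeOn-closing : {k : ℕ} (y : Fin k) (ys : List (Fin k)) → edgeOn y (lastOf y ys) (y ∷ ys) ≡ true
edgeOn-closing y ys = begin
  any (joins y z) (cycEdges (y ∷ ys))                       ≡⟨ cong (any (joins y z)) (cycEdges-∷ y ys) ⟩
  any (joins y z) (pairs (y ∷ ys) ∷ʳ (z , y))               ≡⟨ any-++ (joins y z) (pairs (y ∷ ys)) _ ⟩
  any (joins y z) (pairs (y ∷ ys)) ∨ (joins y z (z , y) ∨ false) ≡⟨ cong (λ b → any (joins y z) (pairs (y ∷ ys)) ∨ (b ∨ false)) closing ⟩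
  any (joins y z) (pairs (y ∷ ys)) ∨ true                   ≡⟨ ∨-zeroʳ _ ⟩
  true                                                      ∎
  where
  open ≡-Reasoning
  z = lastOf y ys
  closing : joins y z (z , y) ≡ true
  closing rewrite dec-true (z ≟ z) refl | dec-true (y ≟ y) refl = ∨-zeroʳ _

-- Contracting an odd cycle

module Contraction
  (G H : Graph) (C : List (Fin (n G))) (c₀ : Fin (n G)) (c₀∈C : c₀ ∈ C)
  (cycleC : IsCycle G C) (oddC : Odd (length C))
  (φ : Fin (n G) → Fin (n H)) (φ-onto : ∀ a → ∃[ u ] φ u ≡ a)
  (φ-identifies : ∀ u v → (φ u ≡ φ v) ⇔ (u ≡ v ⊎ (u ∈ C × v ∈ C)))
  (Adj-H : ∀ a b → Adj H a b ⇔ (a ≢ b × ∃[ u ] ∃[ v ] (φ u ≡ a × φ v ≡ b × Adj G u v)))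
  (FH : OneFactor H) (OH : Orientation H)
  where

  VG = Fin (n G)
  VH = Fin (n H)

  open DecMembership {A = VG} _≟_ using (_∈?_)
  open DecMembership {A = VH} _≟_ using () renaming (_∈?_ to _∈?ᴴ_)

  c : VH
  c = φ c₀

  φ-C : {a : VG} → a ∈ C → φ a ≡ c
  φ-C {a} a∈C = Equivalence.from (φ-identifies a c₀) (inj₂ (a∈C , c₀∈C))

  φ⁻¹-c : {a : VG} → φ a ≡ c → a ∈ C
  φ⁻¹-c {a} eq with Equivalence.to (φ-identifies a c₀) eq
  ... | inj₁ refl = c₀∈C
  ... | inj₂ (a∈C , _) = a∈C

  φ-injective-outside : {a a′ : VG} → a ∉ C → φ a ≡ φ a′ → a ≡ a′
  φ-injective-outside {a} {a′} a∉C eq with Equivalence.to (φ-identifies a a′) eq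
  ... | inj₁ a≡a′ = a≡a′
  ... | inj₂ (a∈C , _) = ⊥-elim (a∉C a∈C)

  Adj-φ : {a b : VG} → Adj G a b → ¬ (a ∈ C × b ∈ C) → Adj H (φ a) (φ b)
  Adj-φ {a} {b} adj ¬both = Equivalence.from (Adj-H (φ a) (φ b)) (φa≢φb , a , b , refl , refl , adj)
    where
    φa≢φb : φ a ≢ φ b
    φa≢φb eq with Equivalence.to (φ-identifies a b) eq
    ... | inj₁ refl = irrefl G adj
    ... | inj₂ both = ¬both both

  w : VH
  w = partner FH c

  private
    cw-witness = Equivalence.to (Adj-H c w) (isEdge FH c)

  c≢w : c ≢ w
  c≢w = proj₁ cw-witness

  -- The end on C of an edge of G that is contracted onto the F-edge cw of H.
  u : VG
  u = proj₁ (proj₂ cw-witness)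

  u∈C : u ∈ C
  u∈C = φ⁻¹-c (proj₁ (proj₂ (proj₂ (proj₂ cw-witness))))

  ψ : VH → VG
  ψ b = if does (b ≟ c) then u else proj₁ (φ-onto b)

  ψ-c : ψ c ≡ u
  ψ-c rewrite dec-true (c ≟ c) refl = refl

  φ∘ψ : (b : VH) → φ (ψ b) ≡ b
  φ∘ψ b with b ≟ c
  ... | yes refl = φ-C u∈C
  ... | no _ = proj₂ (φ-onto b)

  ψ-injective : {b b′ : VH} → ψ b ≡ ψ b′ → b ≡ b′
  ψ-injective {b} {b′} eq = trans (sym (φ∘ψ b)) (trans (cong φ eq) (φ∘ψ b′))

  ψ∉C : {b : VH} → b ≢ c → ψ b ∉ C
  ψ∉C {b} b≢c ψb∈C = b≢c (trans (sym (φ∘ψ b)) (φ-C ψb∈C))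

  ψ-≢C : {p : VH} {a : VG} → p ≢ c → a ∈ C → ψ p ≢ a
  ψ-≢C p≢c a∈C ψp≡a = ψ∉C p≢c (subst (_∈ C) (sym ψp≡a) a∈C)

  C-≢ : {a b : VG} → a ∈ C → b ∉ C → a ≢ b
  C-≢ a∈C b∉C a≡b = b∉C (subst (_∈ C) a≡b a∈C)

  ψ∘φ : {a : VG} → a ∉ C → ψ (φ a) ≡ a
  ψ∘φ {a} a∉C = sym (φ-injective-outside a∉C (sym (φ∘ψ (φ a))))

  ≡ψ : {a : VG} {b : VH} → φ a ≡ b → b ≢ c → a ≡ ψ b
  ≡ψ {a} refl b≢c = sym (ψ∘φ (λ a∈C → b≢c (φ-C a∈C)))

  Adj-ψ : {p q : VH} → p ≢ c → q ≢ c → Adj H p q → Adj G (ψ p) (ψ q)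
  Adj-ψ {p} {q} p≢c q≢c adj with Equivalence.to (Adj-H p q) adj
  ... | _ , x , y , φx , φy , adjxy = subst₂ (Adj G) (≡ψ φx p≢c) (≡ψ φy q≢c) adjxy

  Adj-uψw : Adj G u (ψ w)
  Adj-uψw = subst (Adj G u) (≡ψ φy (c≢w ∘ sym)) (proj₂ (proj₂ (proj₂ (proj₂ (proj₂ cw-witness)))))
    where φy = proj₁ (proj₂ (proj₂ (proj₂ (proj₂ cw-witness))))

  neighbourOnC : {x : VH} → Adj H c x → Σ VG λ g → g ∈ C × Adj G (ψ x) g
  neighbourOnC {x} adj with Equivalence.to (Adj-H c x) adj
  ... | c≢x , g , g′ , φg , φg′ , adjgg′ = g , φ⁻¹-c φg , Adj-sym G (subst (Adj G g) (≡ψ φg′ (c≢x ∘ sym)) adjgg′)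

  private
    split = ∈-∃++ u∈C

  D : List VG
  D = proj₁ (proj₂ split) ++ proj₁ split

  R : List VG
  R = u ∷ D

  R↭C : R ↭ C
  R↭C = subst (R ↭_) (sym (proj₂ (proj₂ split))) (↭-sym (rotate-↭ (proj₁ split) u (proj₁ (proj₂ split))))

  cycEdges-R↭C : cycEdges R ↭ cycEdges C
  cycEdges-R↭C = subst (λ xs → cycEdges R ↭ cycEdges xs) (sym (proj₂ (proj₂ split)))
                       (↭-sym (cycEdges-rotate (proj₁ split) u (proj₁ (proj₂ split))))

  Unique-R : Unique R
  Unique-R = Unique-↭ (↭-sym R↭C) (proj₁ (proj₂ cycleC))

  Adj-cycEdges-R : All (AdjPair {K = G}) (cycEdges R)
  Adj-cycEdges-R = All-resp-↭ (↭-sym cycEdges-R↭C) (proj₂ (proj₂ cycleC))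

  Adj-pairs-R : All (AdjPair {K = G}) (pairs R)
  Adj-pairs-R = ++⁻ˡ (pairs R) (subst (All (AdjPair {K = G})) (cycEdges-∷ u D) Adj-cycEdges-R)

  odd-R : oddᵇ (length R) ≡ true
  odd-R = trans (cong oddᵇ (↭-length R↭C)) (Odd⇒oddᵇ {length C} oddC)

  even-D : oddᵇ (length D) ≡ false
  even-D = trans (sym (not-involutive _)) (cong not odd-R)

  R⇒C : {a : VG} → a ∈ R → a ∈ C
  R⇒C = Any-resp-↭ R↭C

  C⇒R : {a : VG} → a ∈ C → a ∈ R
  C⇒R = Any-resp-↭ (↭-sym R↭C)

  D⇒C : {a : VG} → a ∈ D → a ∈ C
  D⇒C = R⇒C ∘ there

  u∉D : u ∉ D
  u∉D = Unique[x∷xs]⇒x∉xs Unique-R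

  Unique-D : Unique D
  Unique-D = AllPairs.tail Unique-R

  D≢u : {a : VG} → a ∈ D → a ≢ u
  D≢u a∈D refl = u∉D a∈D

  ψ∉D : (b : VH) → ψ b ∉ D
  ψ∉D b = decide (b ≟ c)
    where
    decide : Dec (b ≡ c) → ψ b ∉ D
    decide (yes refl) = subst (_∉ D) (sym ψ-c) u∉D
    decide (no b≢c) = ψ∉C b≢c ∘ D⇒C

  ψ∘φ-outside-D : {a : VG} → a ∉ D → ψ (φ a) ≡ a
  ψ∘φ-outside-D {a} a∉D with a ∈? C
  ... | no a∉C = ψ∘φ a∉C
  ... | yes a∈C with C⇒R a∈C
  ...   | here refl = trans (cong ψ (φ-C u∈C)) ψ-c
  ...   | there a∈D = ⊥-elim (a∉D a∈D)

  -- The second branch also matches u with ψ w, because ψ c = u.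
  partnerG : VG → VG
  partnerG a = if does (a ∈? D) then consecutiveMatching D a else ψ (partner FH (φ a))

  partnerG-D : {a : VG} → a ∈ D → partnerG a ≡ consecutiveMatching D a
  partnerG-D {a} a∈D rewrite dec-true (a ∈? D) a∈D = refl

  partnerG-outside-D : {a : VG} → a ∉ D → partnerG a ≡ ψ (partner FH (φ a))
  partnerG-outside-D {a} a∉D rewrite dec-false (a ∈? D) a∉D = refl

  partnerG-ψ : (b : VH) → partnerG (ψ b) ≡ ψ (partner FH b)
  partnerG-ψ b = trans (partnerG-outside-D (ψ∉D b)) (cong (ψ ∘ partner FH) (φ∘ψ b))

  partnerG-involutive : (a : VG) → partnerG (partnerG a) ≡ a
  partnerG-involutive a with a ∈? D
  ... | yes a∈D = trans (partnerG-D (MatchedIn.partner∈ m)) (MatchedIn.involutive m)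
    where m = consecutiveMatching-matched D Unique-D even-D a∈D
  ... | no a∉D = begin
    partnerG (ψ (partner FH (φ a)))     ≡⟨ partnerG-ψ (partner FH (φ a)) ⟩
    ψ (partner FH (partner FH (φ a)))   ≡⟨ cong ψ (involutive FH (φ a)) ⟩
    ψ (φ a)                             ≡⟨ ψ∘φ-outside-D a∉D ⟩
    a                                   ∎
    where open ≡-Reasoning

  Adj-ψ-partner : (p : VH) → Adj G (ψ p) (ψ (partner FH p))
  Adj-ψ-partner p = decide (p ≟ c) (partner FH p ≟ c)
    where
    decide : Dec (p ≡ c) → Dec (partner FH p ≡ c) → Adj G (ψ p) (ψ (partner FH p))
    decide (yes refl) _ = subst (λ x → Adj G x (ψ w)) (sym ψ-c) Adj-uψw
    decide (no _) (yes q≡c) = subst₂ (Adj G) (cong ψ w≡p) (sym (trans (cong ψ q≡c) ψ-c)) (Adj-sym G Adj-uψw)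
      where
      w≡p : w ≡ p
      w≡p = trans (cong (partner FH) (sym q≡c)) (involutive FH p)
    decide (no p≢c) (no q≢c) = Adj-ψ p≢c q≢c (isEdge FH p)

  partnerG-edge : (a : VG) → Adj G a (partnerG a)
  partnerG-edge a with a ∈? D
  ... | yes a∈D = consecutiveMatching-along (Adj-sym G) D Unique-D even-D (pairs-All-tail u D Adj-pairs-R) a∈D
  ... | no a∉D = subst (λ x → Adj G x (ψ (partner FH (φ a)))) (ψ∘φ-outside-D a∉D) (Adj-ψ-partner (φ a))

  FG : OneFactor G
  FG = record { partner = partnerG ; involutive = partnerG-involutive ; isEdge = partnerG-edge }

  partnerG-u : partnerG u ≡ ψ w
  partnerG-u = trans (sym (cong partnerG ψ-c)) (partnerG-ψ c)

  inF-ψ : (p q : VH) → inF FG (ψ p , ψ q) ≡ inF FH (p , q)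
  inF-ψ p q = trans (cong (λ x → does (x ≟ ψ q)) (partnerG-ψ p))
                    (does-⇔ (mk⇔ ψ-injective (cong ψ)) (ψ (partner FH p) ≟ ψ q) (partner FH p ≟ q))

  Alternating-D : Alternating partnerG true D
  Alternating-D = Alternating-cong D (λ a∈D → sym (partnerG-D a∈D)) (consecutiveMatching-alternating D Unique-D even-D)

  Alternating-R : Alternating partnerG false R
  Alternating-R = prepend D refl Alternating-D
    where
    prepend : (ds : List VG) → D ≡ ds → Alternating partnerG true ds → Alternating partnerG false (u ∷ ds)
    prepend [] _ _ = [ u ]
    prepend (d ∷ ds) D≡ alt = trans (cong (λ x → does (x ≟ d)) partnerG-u) (dec-false (ψ w ≟ d) ψw≢d) ∷ alt
      where
      ψw≢d : ψ w ≢ d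
      ψw≢d ψw≡d = ψ∉D w (subst₂ _∈_ (sym ψw≡d) (sym D≡) (here refl))

  z : VG
  z = lastOf u D

  private
    3≤length-R : 3 ≤ length R
    3≤length-R = subst (3 ≤_) (sym (↭-length R↭C)) (proj₁ cycleC)

  z∈D : z ∈ D
  z∈D = last∈ D refl 3≤length-R
    where
    last∈ : (ds : List VG) → D ≡ ds → 3 ≤ length (u ∷ ds) → lastOf u ds ∈ D
    last∈ [] _ (s≤s ())
    last∈ (d ∷ ds) D≡ _ = subst (lastOf u (d ∷ ds) ∈_) (sym D≡) (lastOf-∈ u d ds)

  Adj-zu : Adj G z u
  Adj-zu with ++⁻ʳ (pairs R) (subst (All (AdjPair {K = G})) (cycEdges-∷ u D) Adj-cycEdges-R)
  ... | adj ∷ [] = adj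

  zu∉FG : inF FG (z , u) ≡ false
  zu∉FG = dec-false (partnerG z ≟ u) λ eq → D≢u (MatchedIn.partner∈ m) (trans (sym (partnerG-D z∈D)) eq)
    where m = consecutiveMatching-matched D Unique-D even-D z∈D

  -- C is oriented cyclically along R: by increasing position, except for the closing edge zu.
  dirC : VG → VG → Bool
  dirC a b = (position R a <ᵇ position R b) xor joins u z (a , b)

  dirC-antisym : {a b : VG} → a ≢ b → a ∈ R → b ∈ R → dirC a b ≡ not (dirC b a)
  dirC-antisym {a} {b} a≢b a∈R b∈R = begin
    (position R a <ᵇ position R b) xor joins u z (a , b)        ≡⟨ cong₂ _xor_ (<ᵇ-asym _ _ (a≢b ∘ position-injective R a∈R b∈R))
                                                                            (sym (joins-swap u z (a , b))) ⟩
    not (position R b <ᵇ position R a) xor joins u z (b , a)    ≡⟨ sym (not-distribˡ-xor (position R b <ᵇ position R a) (joins u z (b , a))) ⟩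
    not ((position R b <ᵇ position R a) xor joins u z (b , a))  ∎
    where open ≡-Reasoning

  dirC-zu : dirC z u ≡ true
  dirC-zu rewrite position-here u D | dec-false (z ≟ u) (D≢u z∈D) | dec-true (z ≟ z) refl | dec-true (u ≟ u) refl = refl

  joins-uz-pairs-R : All (λ e → joins u z e ≡ false) (pairs R)
  joins-uz-pairs-R = check D refl 3≤length-R
    where
    check : (ds : List VG) → D ≡ ds → 3 ≤ length (u ∷ ds) → All (λ e → joins u z e ≡ false) (pairs (u ∷ ds))
    check (_ ∷ []) _ (s≤s (s≤s ()))
    check (d₁ ∷ d₂ ∷ ds) D≡ _ =
      first ∷ All.map (λ (a∈ , b∈) → joins-avoidsˡ (D≢u (in-D a∈)) (D≢u (in-D b∈))) (pairs-∈ (d₁ ∷ d₂ ∷ ds))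
      where
      in-D : ∀ {x} → x ∈ d₁ ∷ d₂ ∷ ds → x ∈ D
      in-D = subst (_ ∈_) (sym D≡)
      d₁≢z : d₁ ≢ z
      d₁≢z d₁≡z = All.lookup (AllPairs.head (subst Unique D≡ Unique-D)) (lastOf-∈ d₁ d₂ ds) (trans d₁≡z (cong (lastOf u) D≡))
      first : joins u z (u , d₁) ≡ false
      first rewrite dec-true (u ≟ u) refl | dec-false (d₁ ≟ z) d₁≢z | dec-false (u ≟ z) (D≢u z∈D ∘ sym) = refl

  dirG : VG → VG → Bool
  dirG a b = if does (a ∈? C) ∧ does (b ∈? C) then dirC a b else dir OH (φ a) (φ b)

  dirG-C : {a b : VG} → a ∈ C → b ∈ C → dirG a b ≡ dirC a b
  dirG-C {a} {b} a∈C b∈C rewrite dec-true (a ∈? C) a∈C | dec-true (b ∈? C) b∈C = refl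

  dirG-outside : {a b : VG} → ¬ (a ∈ C × b ∈ C) → dirG a b ≡ dir OH (φ a) (φ b)
  dirG-outside {a} {b} ¬both with a ∈? C | b ∈? C
  ... | yes a∈C | yes b∈C = ⊥-elim (¬both (a∈C , b∈C))
  ... | yes _ | no _ = refl
  ... | no _ | _ = refl

  dirG-exact : {a b : VG} → Adj G a b → dirG a b ≡ not (dirG b a)
  dirG-exact {a} {b} adj = decide (a ∈? C) (b ∈? C)
    where
    outside : ¬ (a ∈ C × b ∈ C) → dirG a b ≡ not (dirG b a)
    outside ¬both = trans (dirG-outside ¬both) (trans (exact OH (Adj-φ adj ¬both)) (cong not (sym (dirG-outside (¬both ∘ swap)))))
    decide : Dec (a ∈ C) → Dec (b ∈ C) → dirG a b ≡ not (dirG b a)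
    decide (yes a∈C) (yes b∈C) = trans (dirG-C a∈C b∈C)
      (trans (dirC-antisym (λ { refl → irrefl G adj }) (C⇒R a∈C) (C⇒R b∈C)) (cong not (sym (dirG-C b∈C a∈C))))
    decide (yes _) (no b∉C) = outside (b∉C ∘ proj₂)
    decide (no a∉C) _ = outside (a∉C ∘ proj₁)

  OG : Orientation G
  OG = record { dir = dirG ; exact = dirG-exact }

  forward-zu : forward OG (z , u) ≡ true
  forward-zu = trans (dirG-C (D⇒C z∈D) u∈C) dirC-zu

  record AlongC (e : VG × VG) : Set where
    field
      adjacent  : AdjPair {K = G} e
      forwards  : forward OG e ≡ true
      backwards : forward OG (swap e) ≡ false
      fst∈C     : proj₁ e ∈ C
      snd∈C     : proj₂ e ∈ C

  AlongC-pairs-R : All AlongC (pairs R)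
  AlongC-pairs-R = All.map along (All.zip (Adj-pairs-R , All.zip (position-pairs u D Unique-R , All.zip (joins-uz-pairs-R , pairs-∈ R))))
    where
    along : ∀ {e} → AdjPair {K = G} e × (position R (proj₂ e) ≡ suc (position R (proj₁ e))) × joins u z e ≡ false ×
      (proj₁ e ∈ R × proj₂ e ∈ R) → AlongC e
    along {a , b} (adj , next , not-closing , a∈R , b∈R) = record
      { adjacent = adj
      ; forwards = trans (dirG-C (R⇒C a∈R) (R⇒C b∈R))
          (cong₂ _xor_ (trans (cong (position R a <ᵇ_) next) (n<ᵇ1+n (position R a))) not-closing)
      ; backwards = trans (dirG-C (R⇒C b∈R) (R⇒C a∈R))
          (cong₂ _xor_ (trans (cong (_<ᵇ position R a) next) (1+n<ᵇn (position R a))) (trans (joins-swap u z (a , b)) not-closing))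
      ; fst∈C = R⇒C a∈R
      ; snd∈C = R⇒C b∈R
      }

  -- An FG-alternating path along C from v to u that starts with an FG-edge, ends with a non-FG-edge
  -- and has an even number of edges directed forwards.
  record PathToU (v : VG) (q : List VG) : Set where
    field
      tail       : List VG
      starts     : q ≡ v ∷ tail
      ends       : lastOf v tail ≡ u
      onC        : All (_∈ C) q
      unique     : Unique q
      adjacent   : All (AdjPair {K = G}) (pairs q)
      alternates : suc (countᵇ (inF FG) (pairs q) + countᵇ (inF FG) (pairs q)) ≡ length q
      evenlyOriented : oddᵇ (countᵇ (forward OG) (pairs q)) ≡ false

  private
    AlongC-split : (P : List VG) (v : VG) (S : List VG) → R ≡ P ++ v ∷ S → All AlongC (pairs (P ∷ʳ v)) × All AlongC (pairs (v ∷ S))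
    AlongC-split P v S R≡ = ++⁻ˡ (pairs (P ∷ʳ v)) along , ++⁻ʳ (pairs (P ∷ʳ v)) along
      where
      along : All AlongC (pairs (P ∷ʳ v) ++ pairs (v ∷ S))
      along = subst (All AlongC) (pairs-split P v S) (subst (All AlongC ∘ pairs) R≡ AlongC-pairs-R)

  -- v sits at an even position of R: walk back to u.
  pathBackwards : (v : VG) (P S : List VG) → R ≡ P ++ v ∷ S → oddᵇ (length P) ≡ false → PathToU v (reverse (P ∷ʳ v))
  pathBackwards v P S R≡ even = record
    { tail = reverse P
    ; starts = reverse-++ P (v ∷ [])
    ; ends = ends P R≡
    ; onC = All-resp-↭ (↭-sym (↭-reverse X)) (++⁻ˡ X (subst (All (_∈ C)) R≡X++S (All.tabulate R⇒C)))
    ; unique = Unique-↭ (↭-sym (↭-reverse X)) (Unique-++⁻ˡ X (subst Unique R≡X++S Unique-R))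
    ; adjacent = subst (All (AdjPair {K = G})) (sym (pairs-reverse X))
        (All-resp-↭ (↭-sym (↭-reverse _)) (map⁺ (All.map (Adj-sym G ∘ AlongC.adjacent) along)))
    ; alternates = trans (cong (λ m → suc (m + m)) factorEdges)
        (trans (alternates P (Alternating-take P v S (subst (Alternating partnerG false) R≡ Alternating-R)) even) (sym (length-reverse X)))
    ; evenlyOriented = cong oddᵇ (trans (countᵇ-reverse-pairs (forward OG) X) (countᵇ-none (All.map AlongC.backwards along)))
    }
    where
    X = P ∷ʳ v
    R≡X++S : R ≡ X ++ S
    R≡X++S = trans R≡ (sym (++-assoc P (v ∷ []) S))
    along = proj₁ (AlongC-split P v S R≡)
    countᵇ-reverse-pairs : (p : VG × VG → Bool) (xs : List VG) → countᵇ p (pairs (reverse xs)) ≡ countᵇ (p ∘ swap) (pairs xs)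
    countᵇ-reverse-pairs p xs = trans (cong (countᵇ p) (pairs-reverse xs))
      (trans (countᵇ-↭ p (↭-reverse (map swap (pairs xs)))) (countᵇ-map p swap (pairs xs)))
    factorEdges : countᵇ (inF FG) (pairs (reverse X)) ≡ countᵇ (inF FG) (pairs X)
    factorEdges = trans (countᵇ-reverse-pairs (inF FG) X) (countᵇ-cong (All.tabulate {xs = pairs X} (λ {e} _ → inF-swap FG (proj₁ e) (proj₂ e))))
    alternates : (P′ : List VG) → Alternating partnerG false (P′ ∷ʳ v) → oddᵇ (length P′) ≡ false →
      suc (countᵇ (inF FG) (pairs (P′ ∷ʳ v)) + countᵇ (inF FG) (pairs (P′ ∷ʳ v))) ≡ length (P′ ∷ʳ v)
    alternates [] _ _ = refl
    alternates (p ∷ P′) alt even′ =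
      cong suc (Alternating-countᵇ p (P′ ∷ʳ v) alt (trans (cong oddᵇ (trans (length-++ P′) (+-comm (length P′) 1))) even′))
    ends : (P′ : List VG) → R ≡ P′ ++ v ∷ S → lastOf v (reverse P′) ≡ u
    ends [] R≡′ = sym (∷-injectiveˡ R≡′)
    ends (p ∷ P′) R≡′ = trans (cong (lastOf v) (unfold-reverse p P′)) (trans (lastOf-++ v (reverse P′) p []) (sym (∷-injectiveˡ R≡′)))

  oddPrefix⇒oddSuffix : (P : List VG) {v : VG} {S : List VG} → R ≡ P ++ v ∷ S → oddᵇ (length P) ≡ true → oddᵇ (length S) ≡ true
  oddPrefix⇒oddSuffix P {v} {S} R≡ odd = begin
    oddᵇ (length S)                             ≡⟨ sym (not-involutive _) ⟩
    true xor oddᵇ (suc (length S))              ≡⟨ cong (_xor oddᵇ (suc (length S))) (sym odd) ⟩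
    oddᵇ (length P) xor oddᵇ (suc (length S))   ≡⟨ sym (oddᵇ-+ (length P) (suc (length S))) ⟩
    oddᵇ (length P + suc (length S))            ≡⟨ cong oddᵇ (sym (length-++ P)) ⟩
    oddᵇ (length (P ++ v ∷ S))                  ≡⟨ cong (oddᵇ ∘ length) (sym R≡) ⟩
    oddᵇ (length R)                             ≡⟨ odd-R ⟩
    true                                        ∎
    where open ≡-Reasoning

  -- v sits at an odd position of R: walk forwards to u, through the closing edge zu.
  pathForwards : (v : VG) (P S : List VG) → R ≡ P ++ v ∷ S → oddᵇ (length P) ≡ true → PathToU v (v ∷ S ∷ʳ u)
  pathForwards v (p ∷ P′) S R≡ odd = record
    { tail = S ∷ʳ u
    ; starts = refl
    ; ends = lastOf-++ v S u []
    ; onC = ++⁺ (All.map R⇒C (++⁻ʳ (p ∷ P′) (subst (All (_∈ R)) R≡ (All.tabulate (λ x∈R → x∈R))))) (u∈C ∷ [])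
    ; unique = Unique-↭ (∷↭∷ʳ u (v ∷ S)) (All.tabulate (λ x∈vS u≡x → u∉vS (subst (_∈ v ∷ S) (sym u≡x) x∈vS)) ∷ Unique-vS)
    ; adjacent = subst (All (AdjPair {K = G})) (sym edges) (++⁺ (All.map AlongC.adjacent along) (subst (λ x → Adj G x u) (sym last≡z) Adj-zu ∷ []))
    ; alternates = begin
        suc (countᵇ (inF FG) (pairs (v ∷ S ∷ʳ u)) + countᵇ (inF FG) (pairs (v ∷ S ∷ʳ u)))  ≡⟨ cong (λ m → suc (m + m)) factorEdges ⟩
        suc (m + m)                                                                       ≡⟨ cong suc (Alternating-countᵇ v S Alternating-vS odd-S) ⟩
        suc (suc (length S))                                                              ≡⟨ cong suc (trans (+-comm 1 (length S)) (sym (length-++ S))) ⟩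
        length (v ∷ S ∷ʳ u)                                                               ∎
    ; evenlyOriented = begin
        oddᵇ (countᵇ (forward OG) (pairs (v ∷ S ∷ʳ u)))   ≡⟨ cong oddᵇ forwardEdges ⟩
        oddᵇ (length S + 1)                               ≡⟨ oddᵇ-+ (length S) 1 ⟩
        oddᵇ (length S) xor true                          ≡⟨ cong (_xor true) odd-S ⟩
        false                                             ∎
    }
    where
    open ≡-Reasoning
    P = p ∷ P′
    along = proj₂ (AlongC-split P v S R≡)
    D≡ : D ≡ P′ ++ v ∷ S
    D≡ = ∷-injectiveʳ R≡
    last≡z : lastOf v S ≡ z
    last≡z = sym (trans (cong (lastOf u) D≡) (lastOf-++ u P′ v S))
    edges : pairs (v ∷ S ∷ʳ u) ≡ pairs (v ∷ S) ∷ʳ (lastOf v S , u)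
    edges = pairs-∷ʳ v S u
    Unique-vS : Unique (v ∷ S)
    Unique-vS = Unique-++⁻ʳ P (subst Unique R≡ Unique-R)
    u∉vS : u ∉ v ∷ S
    u∉vS u∈vS = u∉D (subst (u ∈_) (sym D≡) (∈-++⁺ʳ P′ u∈vS))
    odd-S : oddᵇ (length S) ≡ true
    odd-S = oddPrefix⇒oddSuffix P R≡ odd
    Alternating-vS : Alternating partnerG true (v ∷ S)
    Alternating-vS = subst (λ b → Alternating partnerG b (v ∷ S)) (trans (xor-identityʳ _) odd)
                           (Alternating-drop P (subst (Alternating partnerG false) R≡ Alternating-R))
    m = countᵇ (inF FG) (pairs (v ∷ S))
    factorEdges : countᵇ (inF FG) (pairs (v ∷ S ∷ʳ u)) ≡ m
    factorEdges = begin
      countᵇ (inF FG) (pairs (v ∷ S ∷ʳ u))       ≡⟨ cong (countᵇ (inF FG)) edges ⟩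
      countᵇ (inF FG) (pairs (v ∷ S) ∷ʳ (lastOf v S , u)) ≡⟨ countᵇ-++ (inF FG) (pairs (v ∷ S)) _ ⟩
      m + (𝟙 (inF FG (lastOf v S , u)) + 0)      ≡⟨ cong (λ x → m + (𝟙 (inF FG (x , u)) + 0)) last≡z ⟩
      m + (𝟙 (inF FG (z , u)) + 0)               ≡⟨ cong (λ b → m + (𝟙 b + 0)) zu∉FG ⟩
      m + 0                                      ≡⟨ +-identityʳ m ⟩
      m                                          ∎
    forwardEdges : countᵇ (forward OG) (pairs (v ∷ S ∷ʳ u)) ≡ length S + 1
    forwardEdges = begin
      countᵇ (forward OG) (pairs (v ∷ S ∷ʳ u))                    ≡⟨ cong (countᵇ (forward OG)) edges ⟩
      countᵇ (forward OG) (pairs (v ∷ S) ∷ʳ (lastOf v S , u))     ≡⟨ countᵇ-++ (forward OG) (pairs (v ∷ S)) _ ⟩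
      countᵇ (forward OG) (pairs (v ∷ S)) + (𝟙 (forward OG (lastOf v S , u)) + 0)
        ≡⟨ cong₂ (λ k x → k + (𝟙 (forward OG (x , u)) + 0)) (trans (countᵇ-all (All.map AlongC.forwards along)) (length-pairs v S)) last≡z ⟩
      length S + (𝟙 (forward OG (z , u)) + 0)                     ≡⟨ cong (λ b → length S + (𝟙 b + 0)) forward-zu ⟩
      length S + 1                                                ∎

  pathToU : VG → List VG
  pathToU v = if oddᵇ (length (proj₁ (breakAt v R))) then v ∷ proj₂ (breakAt v R) ∷ʳ u else reverse (proj₁ (breakAt v R) ∷ʳ v)

  pathToU-PathToU : {v : VG} → v ∈ C → PathToU v (pathToU v)
  pathToU-PathToU {v} v∈C with oddᵇ (length (proj₁ (breakAt v R))) in parity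
  ... | true  = pathForwards v _ _ (breakAt-++ v R (C⇒R v∈C)) parity
  ... | false = pathBackwards v _ _ (breakAt-++ v R (C⇒R v∈C)) parity

  ψ-≟ : (p : VH) {a : VG} → a ∉ C → does (ψ p ≟ a) ≡ does (p ≟ φ a)
  ψ-≟ p {a} a∉C = does-⇔ (mk⇔ (λ ψp≡a → trans (sym (φ∘ψ p)) (cong φ ψp≡a)) (λ p≡φa → trans (cong ψ p≡φa) (ψ∘φ a∉C)))
                         (ψ p ≟ a) (p ≟ φ a)

  joins-ψ : {a b : VG} (e : VH × VH) → a ∉ C → b ∉ C → joins a b (Product.map ψ ψ e) ≡ joins (φ a) (φ b) e
  joins-ψ (p , q) a∉C b∉C = cong₂ _∨_ (cong₂ _∧_ (ψ-≟ p a∉C) (ψ-≟ q b∉C)) (cong₂ _∧_ (ψ-≟ p b∉C) (ψ-≟ q a∉C))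

  forward-ψ : {p q : VH} → p ≢ c → forward OG (ψ p , ψ q) ≡ dir OH p q
  forward-ψ {p} {q} p≢c = trans (dirG-outside (ψ∉C p≢c ∘ proj₁)) (cong₂ (dir OH) (φ∘ψ p) (φ∘ψ q))

  AvoidsC : VH × VH → Set
  AvoidsC (p , q) = p ≢ c × q ≢ c

  -- A cycle of G lifting the cycle N of H, with its edges accounted for by those of N; attach y is the
  -- vertex of C on which the lift of an edge cy of N lands.
  module Lifting (attach : VH → VG) where

    crossingEnd : VG → VG → Bool
    crossingEnd a b = if does (w ≟ φ b) then does (u ≟ a) else does (attach (φ b) ≟ a)

    onPathToU : VG → VG → VG → Bool
    onPathToU a b v = any (joins a b) (pairs (pathToU v))

    viaPath : VG → VG → List VH → VH → Bool
    viaPath a b N y = edgeOn c y N ∧ (not (does (y ≟ w)) ∧ onPathToU a b (attach y))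

    record Lifts (L : List VG) (N : List VH) : Set where
      field
        good     : EvenAlternatingCycle FG OG L
        outside  : ∀ a b → a ∉ C → b ∉ C → edgeOn a b L ≡ edgeOn (φ a) (φ b) N
        crossing : ∀ a b → a ∈ C → b ∉ C → edgeOn a b L ≡ edgeOn c (φ b) N ∧ crossingEnd a b
        insideC  : ∀ a b → a ∈ C → b ∈ C → edgeOn a b L ≡ xorSum (viaPath a b N) (allFin (n H))

    Lifts-SameEdges : {L : List VG} {N N′ : List VH} → Lifts L N → SameEdges N N′ → Lifts L N′
    Lifts-SameEdges lifts same = record
      { good = good
      ; outside = λ a b a∉C b∉C → trans (outside a b a∉C b∉C) (same (φ a) (φ b))
      ; crossing = λ a b a∈C b∉C → trans (crossing a b a∈C b∉C) (cong (_∧ crossingEnd a b) (same c (φ b)))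
      ; insideC = λ a b a∈C b∈C → trans (insideC a b a∈C b∈C)
          (xorSum-cong (All.tabulate {xs = allFin (n H)} (λ {y} _ → cong (_∧ (not (does (y ≟ w)) ∧ onPathToU a b (attach y))) (same c y))))
      }
      where open Lifts lifts

    liftAvoiding : (N : List VH) → EvenAlternatingCycle FH OH N → All (_≢ c) N → Lifts (map ψ N) N
    liftAvoiding N goodN avoids = record
      { good = record
        { isCycle = subst (3 ≤_) (sym (length-map ψ N)) (proj₁ isCycle)
                  , Unique-map⁺ ψ-injective (proj₁ (proj₂ isCycle))
                  , subst (All (AdjPair {K = G})) (sym edges)
                      (map⁺ (All.map (λ ((p≢c , q≢c) , adj) → Adj-ψ p≢c q≢c adj) (All.zip (avoids₂ , proj₂ (proj₂ isCycle)))))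
        ; alternating = trans (cong length edges) (trans (length-map ψ₂ E) (trans alternating (cong (2 *_) (sym factorEdges))))
        ; evenlyOriented = subst Even (sym forwardEdges) evenlyOriented
        }
      ; outside = λ a b a∉C b∉C → trans (edgeOn-lift a b) (any-cong (All.tabulate {xs = E} (λ {e} _ → joins-ψ e a∉C b∉C)))
      ; crossing = λ a b a∈C _ → trans (notOnC a b a∈C) (sym (cong (_∧ crossingEnd a b) (noEdgeAt-c (φ b))))
      ; insideC = λ a b a∈C _ → trans (notOnC a b a∈C)
          (sym (xorSum-none (All.tabulate {xs = allFin (n H)} (λ {y} _ → cong (_∧ (not (does (y ≟ w)) ∧ onPathToU a b (attach y))) (noEdgeAt-c y)))))
      }
      where
      open EvenAlternatingCycle goodN
      ψ₂ = Product.map ψ ψ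
      E = cycEdges N
      avoids₂ : All AvoidsC E
      avoids₂ = cycEdges-All avoids
      edges : cycEdges (map ψ N) ≡ map ψ₂ E
      edges = cycEdges-map ψ N
      factorEdges : countᵇ (inF FG) (cycEdges (map ψ N)) ≡ countᵇ (inF FH) E
      factorEdges = trans (cong (countᵇ (inF FG)) edges)
        (trans (countᵇ-map (inF FG) ψ₂ E) (countᵇ-cong (All.tabulate {xs = E} (λ {e} _ → inF-ψ (proj₁ e) (proj₂ e)))))
      forwardEdges : countᵇ (forward OG) (cycEdges (map ψ N)) ≡ countᵇ (forward OH) E
      forwardEdges = trans (cong (countᵇ (forward OG)) edges)
        (trans (countᵇ-map (forward OG) ψ₂ E) (countᵇ-cong (All.map (forward-ψ ∘ proj₁) avoids₂)))
      edgeOn-lift : (a b : VG) → edgeOn a b (map ψ N) ≡ any (joins a b ∘ ψ₂) E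
      edgeOn-lift a b = trans (cong (any (joins a b)) edges) (any-map (joins a b) ψ₂ E)
      noEdgeAt-c : (y : VH) → edgeOn c y N ≡ false
      noEdgeAt-c y = any-none {xs = E} (All.map (λ (p≢c , q≢c) → joins-avoidsˡ p≢c q≢c) avoids₂)
      notOnC : (a b : VG) → a ∈ C → edgeOn a b (map ψ N) ≡ false
      notOnC a b a∈C = trans (edgeOn-lift a b)
        (any-none {xs = E} (All.map (λ (p≢c , q≢c) → joins-avoidsˡ (ψ-≢C p≢c a∈C) (ψ-≢C q≢c a∈C)) avoids₂))

    -- A cycle through c, traversed from c along its FH-edge cw, is lifted by replacing the vertex c
    -- with the path from attach x to u, where x is the last vertex of the cycle.
    module Through (B : List VH) (goodN : EvenAlternatingCycle FH OH (c ∷ w ∷ B))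
                   (v∈C : attach (lastOf w B) ∈ C) (Adj-xv : Adj G (ψ (lastOf w B)) (attach (lastOf w B))) where

      open EvenAlternatingCycle goodN
      open PathToU (pathToU-PathToU v∈C) using (tail; starts; ends; onC; unique; adjacent; alternates)
        renaming (evenlyOriented to path-evenlyOriented)

      N : List VH
      N = c ∷ w ∷ B

      x : VH
      x = lastOf w B

      v : VG
      v = attach x

      q : List VG
      q = pathToU v

      L : List VG
      L = map ψ (w ∷ B) ++ q

      ψ₂ = Product.map ψ ψ
      PB = pairs (w ∷ B)

      x∈B : x ∈ B
      x∈B = last∈ B (proj₁ isCycle)
        where
        last∈ : (B′ : List VH) → 3 ≤ length (c ∷ w ∷ B′) → lastOf w B′ ∈ B′
        last∈ [] (s≤s (s≤s ()))
        last∈ (b ∷ B′) _ = lastOf-∈ w b B′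

      wB≢c : All (_≢ c) (w ∷ B)
      wB≢c = All.map (_∘ sym) (AllPairs.head (proj₁ (proj₂ isCycle)))

      x≢c : x ≢ c
      x≢c = All.lookup wB≢c (there x∈B)

      w≢c : w ≢ c
      w≢c = c≢w ∘ sym

      x≢w : x ≢ w
      x≢w x≡w = Unique[x∷xs]⇒x∉xs (AllPairs.tail (proj₁ (proj₂ isCycle))) (subst (_∈ B) x≡w x∈B)

      edgesN : cycEdges N ≡ (c , w) ∷ (PB ∷ʳ (x , c))
      edgesN = cycEdges-∷ c (w ∷ B)

      edgesL : cycEdges L ≡ map ψ₂ PB ++ (ψ x , v) ∷ (pairs q ∷ʳ (u , ψ w))
      edgesL = subst (λ q′ → cycEdges (map ψ (w ∷ B) ++ q′) ≡ map ψ₂ PB ++ (ψ x , v) ∷ (pairs q′ ∷ʳ (u , ψ w))) (sym starts) (begin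
        cycEdges (ψ w ∷ map ψ B ++ v ∷ tail)
          ≡⟨ cycEdges-∷ (ψ w) (map ψ B ++ v ∷ tail) ⟩
        pairs (ψ w ∷ map ψ B ++ v ∷ tail) ∷ʳ (lastOf (ψ w) (map ψ B ++ v ∷ tail) , ψ w)
          ≡⟨ cong₂ (λ es y → es ∷ʳ (y , ψ w)) (pairs-++ (ψ w) (map ψ B) v tail) (trans (lastOf-++ (ψ w) (map ψ B) v tail) ends) ⟩
        (pairs (ψ w ∷ map ψ B) ++ (lastOf (ψ w) (map ψ B) , v) ∷ pairs (v ∷ tail)) ∷ʳ (u , ψ w)
          ≡⟨ ++-assoc (pairs (ψ w ∷ map ψ B)) _ _ ⟩
        pairs (ψ w ∷ map ψ B) ++ (lastOf (ψ w) (map ψ B) , v) ∷ (pairs (v ∷ tail) ∷ʳ (u , ψ w))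
          ≡⟨ cong₂ (λ es y → es ++ (y , v) ∷ (pairs (v ∷ tail) ∷ʳ (u , ψ w))) (pairs-map ψ (w ∷ B)) (lastOf-map ψ w B) ⟩
        map ψ₂ PB ++ (ψ x , v) ∷ (pairs (v ∷ tail) ∷ʳ (u , ψ w))  ∎)
        where open ≡-Reasoning

      PB≢c : All AvoidsC PB
      PB≢c = pairs-All wB≢c

      Adj-PB : All (AdjPair {K = H}) PB
      Adj-PB = ++⁻ˡ PB (All.tail (subst (All (AdjPair {K = H})) edgesN (proj₂ (proj₂ isCycle))))

      length-q : length q ≡ suc (length (pairs q))
      length-q = trans (cong length starts) (cong suc (trans (sym (length-pairs v tail)) (cong (length ∘ pairs) (sym starts))))

      isCycle-L : IsCycle G L
      isCycle-L = subst (3 ≤_) (sym (trans (length-++ (map ψ (w ∷ B))) (cong₂ _+_ (length-map ψ (w ∷ B)) length-q)))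
                        (+-mono-≤ (s≤s (nonEmpty B (proj₁ isCycle))) (s≤s z≤n))
                , Unique-++⁺ (Unique-map⁺ ψ-injective (AllPairs.tail (proj₁ (proj₂ isCycle)))) unique disjoint
                , subst (All (AdjPair {K = G})) (sym edgesL)
                    (++⁺ (map⁺ (All.map (λ ((p≢c , q≢c) , adj) → Adj-ψ p≢c q≢c adj) (All.zip (PB≢c , Adj-PB))))
                         (Adj-xv ∷ ++⁺ adjacent (Adj-uψw ∷ [])))
        where
        nonEmpty : (B′ : List VH) → 3 ≤ length (c ∷ w ∷ B′) → 1 ≤ length B′
        nonEmpty B′ (s≤s (s≤s 1≤)) = 1≤
        disjoint : ∀ {y} → y ∈ map ψ (w ∷ B) × y ∈ q → ⊥
        disjoint (y∈ψwB , y∈q) with ∈-map⁻ ψ y∈ψwB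
        ... | p , p∈wB , refl = ψ∉C (All.lookup wB≢c p∈wB) (All.lookup onC y∈q)

      factorEdges-L : countᵇ (inF FG) (cycEdges L) ≡ countᵇ (inF FH) PB + (countᵇ (inF FG) (pairs q) + 1)
      factorEdges-L = begin
        countᵇ (inF FG) (cycEdges L)                                                  ≡⟨ cong (countᵇ (inF FG)) edgesL ⟩
        countᵇ (inF FG) (map ψ₂ PB ++ (ψ x , v) ∷ (pairs q ∷ʳ (u , ψ w)))            ≡⟨ countᵇ-++ (inF FG) (map ψ₂ PB) _ ⟩
        countᵇ (inF FG) (map ψ₂ PB) + (𝟙 (inF FG (ψ x , v)) + countᵇ (inF FG) (pairs q ∷ʳ (u , ψ w)))
          ≡⟨ cong₂ (λ m b → m + (𝟙 b + countᵇ (inF FG) (pairs q ∷ʳ (u , ψ w)))) lifted xv∉FG ⟩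
        countᵇ (inF FH) PB + countᵇ (inF FG) (pairs q ∷ʳ (u , ψ w))
          ≡⟨ cong (countᵇ (inF FH) PB +_) (countᵇ-++ (inF FG) (pairs q) _) ⟩
        countᵇ (inF FH) PB + (countᵇ (inF FG) (pairs q) + (𝟙 (inF FG (u , ψ w)) + 0))
          ≡⟨ cong (λ b → countᵇ (inF FH) PB + (countᵇ (inF FG) (pairs q) + (𝟙 b + 0))) uψw∈FG ⟩
        countᵇ (inF FH) PB + (countᵇ (inF FG) (pairs q) + 1)                         ∎
        where
        open ≡-Reasoning
        lifted : countᵇ (inF FG) (map ψ₂ PB) ≡ countᵇ (inF FH) PB
        lifted = trans (countᵇ-map (inF FG) ψ₂ PB) (countᵇ-cong (All.tabulate {xs = PB} (λ {e} _ → inF-ψ (proj₁ e) (proj₂ e))))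
        xv∉FG : inF FG (ψ x , v) ≡ false
        xv∉FG = dec-false (partnerG (ψ x) ≟ v) λ eq → ψ∉C px≢c (subst (_∈ C) (sym (trans (sym (partnerG-ψ x)) eq)) v∈C)
          where
          px≢c : partner FH x ≢ c
          px≢c px≡c = x≢w (trans (sym (involutive FH x)) (cong (partner FH) px≡c))
        uψw∈FG : inF FG (u , ψ w) ≡ true
        uψw∈FG = dec-true (partnerG u ≟ ψ w) partnerG-u

      factorEdges-N : countᵇ (inF FH) (cycEdges N) ≡ suc (countᵇ (inF FH) PB + 0)
      factorEdges-N = trans (cong (countᵇ (inF FH)) edgesN)
        (trans (cong (λ b → 𝟙 b + countᵇ (inF FH) (PB ∷ʳ (x , c))) (dec-true (partner FH c ≟ w) refl))
        (cong suc (trans (countᵇ-++ (inF FH) PB _) (cong (λ b → countᵇ (inF FH) PB + (𝟙 b + 0)) xc∉FH))))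
        where
        xc∉FH : inF FH (x , c) ≡ false
        xc∉FH = dec-false (partner FH x ≟ c) λ px≡c → x≢w (trans (sym (involutive FH x)) (cong (partner FH) px≡c))

      alternating-L : FAlternating FG L
      alternating-L = begin
        length (cycEdges L)                       ≡⟨ cong length edgesL ⟩
        length (map ψ₂ PB ++ (ψ x , v) ∷ (pairs q ∷ʳ (u , ψ w)))
                                                  ≡⟨ trans (length-++ (map ψ₂ PB)) (cong₂ _+_ (length-map ψ₂ PB) (cong suc (length-++ (pairs q)))) ⟩
        length PB + suc (length (pairs q) + 1)    ≡⟨ cong₂ (λ l l′ → l + suc (l′ + 1)) PB-halved q-halved ⟩
        (k + k) + suc ((m + m) + 1)               ≡⟨ solve 2 (λ k m → (k :+ k) :+ (con 1 :+ ((m :+ m) :+ con 1)) := con 2 :* (k :+ (m :+ con 1))) refl k m ⟩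
        2 * (k + (m + 1))                         ≡⟨ cong (2 *_) (sym factorEdges-L) ⟩
        2 * countᵇ (inF FG) (cycEdges L)          ∎
        where
        open ≡-Reasoning
        k = countᵇ (inF FH) PB
        m = countᵇ (inF FG) (pairs q)
        PB-halved : length PB ≡ k + k
        PB-halved = suc-injective (suc-injective (begin
          suc (suc (length PB))               ≡⟨ cong suc (+-comm 1 (length PB)) ⟩
          suc (length PB + 1)                 ≡⟨ cong suc (sym (length-++ PB)) ⟩
          length ((c , w) ∷ (PB ∷ʳ (x , c)))  ≡⟨ cong length (sym edgesN) ⟩
          length (cycEdges N)                 ≡⟨ alternating ⟩
          2 * countᵇ (inF FH) (cycEdges N)    ≡⟨ cong (2 *_) factorEdges-N ⟩
          2 * suc (k + 0)                     ≡⟨ solve 1 (λ k → con 2 :* (con 1 :+ (k :+ con 0)) := con 2 :+ (k :+ k)) refl k ⟩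
          suc (suc (k + k))                   ∎))
        q-halved : length (pairs q) ≡ m + m
        q-halved = suc-injective (trans (sym length-q) (sym alternates))

      evenlyOriented-L : EvenlyOriented OG L
      evenlyOriented-L = ¬oddᵇ⇒Even {countᵇ (forward OG) (cycEdges L)} (begin
        oddᵇ (countᵇ (forward OG) (cycEdges L))   ≡⟨ cong oddᵇ (trans forwardEdges-L rearrange) ⟩
        oddᵇ (countᵇ (forward OH) (cycEdges N) + fQ)  ≡⟨ oddᵇ-+ (countᵇ (forward OH) (cycEdges N)) fQ ⟩
        oddᵇ (countᵇ (forward OH) (cycEdges N)) xor oddᵇ fQ
          ≡⟨ cong₂ _xor_ (Even⇒¬oddᵇ {countᵇ (forward OH) (cycEdges N)} evenlyOriented) path-evenlyOriented ⟩
        false                                      ∎)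
        where
        open ≡-Reasoning
        fB = countᵇ (forward OH) PB
        fQ = countᵇ (forward OG) (pairs q)
        xc = 𝟙 (dir OH x c)
        cw = 𝟙 (dir OH c w)
        forwardEdges-L : countᵇ (forward OG) (cycEdges L) ≡ fB + (xc + (fQ + (cw + 0)))
        forwardEdges-L = begin
          countᵇ (forward OG) (cycEdges L)   ≡⟨ cong (countᵇ (forward OG)) edgesL ⟩
          countᵇ (forward OG) (map ψ₂ PB ++ (ψ x , v) ∷ (pairs q ∷ʳ (u , ψ w)))
            ≡⟨ countᵇ-++ (forward OG) (map ψ₂ PB) _ ⟩
          countᵇ (forward OG) (map ψ₂ PB) + (𝟙 (forward OG (ψ x , v)) + countᵇ (forward OG) (pairs q ∷ʳ (u , ψ w)))
            ≡⟨ cong₂ (λ k b → k + (𝟙 b + countᵇ (forward OG) (pairs q ∷ʳ (u , ψ w)))) lifted xv ⟩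
          fB + (xc + countᵇ (forward OG) (pairs q ∷ʳ (u , ψ w)))
            ≡⟨ cong (λ k → fB + (xc + k)) (countᵇ-++ (forward OG) (pairs q) _) ⟩
          fB + (xc + (fQ + (𝟙 (forward OG (u , ψ w)) + 0)))
            ≡⟨ cong (λ b → fB + (xc + (fQ + (𝟙 b + 0)))) uw ⟩
          fB + (xc + (fQ + (cw + 0)))        ∎
          where
          lifted : countᵇ (forward OG) (map ψ₂ PB) ≡ fB
          lifted = trans (countᵇ-map (forward OG) ψ₂ PB) (countᵇ-cong (All.map (forward-ψ ∘ proj₁) PB≢c))
          xv : forward OG (ψ x , v) ≡ dir OH x c
          xv = trans (dirG-outside (ψ∉C x≢c ∘ proj₁)) (cong₂ (dir OH) (φ∘ψ x) (φ-C v∈C))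
          uw : forward OG (u , ψ w) ≡ dir OH c w
          uw = trans (dirG-outside (ψ∉C w≢c ∘ proj₂)) (cong₂ (dir OH) (φ-C u∈C) (φ∘ψ w))
        rearrange : fB + (xc + (fQ + (cw + 0))) ≡ countᵇ (forward OH) (cycEdges N) + fQ
        rearrange = trans (solve 4 (λ b x q w → b :+ (x :+ (q :+ (w :+ con 0))) := (w :+ (b :+ (x :+ con 0))) :+ q) refl fB xc fQ cw)
                          (cong (_+ fQ) (sym (trans (cong (countᵇ (forward OH)) edgesN) (cong (cw +_) (countᵇ-++ (forward OH) PB _)))))

      edgeOn-L : (a b : VG) → edgeOn a b L ≡
        any (joins a b) (map ψ₂ PB) ∨ (joins a b (ψ x , v) ∨ (onPathToU a b v ∨ (joins a b (u , ψ w) ∨ false)))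
      edgeOn-L a b = trans (cong (any (joins a b)) edgesL) (trans (any-++ (joins a b) (map ψ₂ PB) _)
        (cong (λ t → any (joins a b) (map ψ₂ PB) ∨ (joins a b (ψ x , v) ∨ t)) (any-++ (joins a b) (pairs q) _)))

      edgeOn-N : (α β : VH) → edgeOn α β N ≡ joins α β (c , w) ∨ (any (joins α β) PB ∨ (joins α β (x , c) ∨ false))
      edgeOn-N α β = trans (cong (any (joins α β)) edgesN) (cong (joins α β (c , w) ∨_) (any-++ (joins α β) PB _))

      edgeOn-N-c : (y : VH) → edgeOn c y N ≡ does (w ≟ y) ∨ does (x ≟ y)
      edgeOn-N-c y rewrite edgeOn-N c y | dec-true (c ≟ c) refl | dec-false (w ≟ c) w≢c | dec-false (x ≟ c) x≢c
                         | any-none {xs = PB} (All.map (λ (p≢c , q≢c) → joins-avoidsˡ {v = y} p≢c q≢c) PB≢c)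
                         | ∧-zeroʳ (does (c ≟ y)) | ∧-identityʳ (does (x ≟ y)) | ∨-identityʳ (does (w ≟ y)) | ∨-identityʳ (does (x ≟ y)) = refl

      liftedAvoidsC : (a b : VG) → a ∈ C → any (joins a b) (map ψ₂ PB) ≡ false
      liftedAvoidsC a b a∈C =
        trans (any-map (joins a b) ψ₂ PB) (any-none (All.map (λ (p≢c , q≢c) → joins-avoidsˡ (ψ-≢C p≢c a∈C) (ψ-≢C q≢c a∈C)) PB≢c))

      pathAvoids : (a : VG) → a ∉ C → All (λ e → proj₁ e ≢ a × proj₂ e ≢ a) (pairs q)
      pathAvoids a a∉C = All.map (λ (p∈q , p′∈q) → C-≢ (All.lookup onC p∈q) a∉C , C-≢ (All.lookup onC p′∈q) a∉C) (pairs-∈ q)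

      outside-L : ∀ a b → a ∉ C → b ∉ C → edgeOn a b L ≡ edgeOn (φ a) (φ b) N
      outside-L a b a∉C b∉C = begin
        edgeOn a b L
          ≡⟨ edgeOn-L a b ⟩
        any (joins a b) (map ψ₂ PB) ∨ (joins a b (ψ x , v) ∨ (onPathToU a b v ∨ (joins a b (u , ψ w) ∨ false)))
          ≡⟨ cong₂ _∨_ lifted (cong₂ _∨_ (joins-avoids₂ {u = a} {v = b} {a = ψ x} (C-≢ v∈C a∉C) (C-≢ v∈C b∉C))
               (cong₂ _∨_ (any-none {xs = pairs q} (All.map (λ (≢a , ≢a′) → joins-avoidsˡ {v = b} ≢a ≢a′) (pathAvoids a a∉C)))
                          (cong (_∨ false) (joins-avoids₁ {u = a} {v = b} {a = u} {b = ψ w} (C-≢ u∈C a∉C) (C-≢ u∈C b∉C))))) ⟩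
        any (joins (φ a) (φ b)) PB ∨ false
          ≡⟨ cong₂ _∨_ (sym (joins-avoids₁ {u = φ a} {v = φ b} {a = c} {b = w} (c≢φ a∉C) (c≢φ b∉C)))
               (cong (any (joins (φ a) (φ b)) PB ∨_) (cong (_∨ false) (sym (joins-avoids₂ {u = φ a} {v = φ b} {a = x} {b = c} (c≢φ a∉C) (c≢φ b∉C))))) ⟩
        joins (φ a) (φ b) (c , w) ∨ (any (joins (φ a) (φ b)) PB ∨ (joins (φ a) (φ b) (x , c) ∨ false))
          ≡⟨ sym (edgeOn-N (φ a) (φ b)) ⟩
        edgeOn (φ a) (φ b) N ∎
        where
        open ≡-Reasoning
        lifted : any (joins a b) (map ψ₂ PB) ≡ any (joins (φ a) (φ b)) PB
        lifted = trans (any-map (joins a b) ψ₂ PB) (any-cong (All.tabulate {xs = PB} (λ {e} _ → joins-ψ e a∉C b∉C)))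
        c≢φ : ∀ {a′} → a′ ∉ C → c ≢ φ a′
        c≢φ a′∉C c≡φa′ = a′∉C (φ⁻¹-c (sym c≡φa′))

      crossing-L : ∀ a b → a ∈ C → b ∉ C → edgeOn a b L ≡ edgeOn c (φ b) N ∧ crossingEnd a b
      crossing-L a b a∈C b∉C = begin
        edgeOn a b L
          ≡⟨ edgeOn-L a b ⟩
        any (joins a b) (map ψ₂ PB) ∨ (joins a b (ψ x , v) ∨ (onPathToU a b v ∨ (joins a b (u , ψ w) ∨ false)))
          ≡⟨ cong₂ _∨_ (liftedAvoidsC a b a∈C) (cong₂ _∨_ xv (cong₂ _∨_ onPath (cong (_∨ false) uw))) ⟩
        (does (x ≟ φ b) ∧ does (v ≟ a)) ∨ (false ∨ (((does (u ≟ a) ∧ does (w ≟ φ b)) ∨ false) ∨ false))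
          ≡⟨ crossing-∨ (does (x ≟ φ b)) (does (w ≟ φ b)) (does (u ≟ a)) (does (v ≟ a)) (does (attach (φ b) ≟ a))
               (λ w≡φb → dec-false (x ≟ φ b) (λ x≡φb → x≢w (trans x≡φb (sym (does≡true⇒≡ w≡φb)))))
               (λ x≡φb → cong (λ y → does (attach y ≟ a)) (sym (does≡true⇒≡ x≡φb))) ⟩
        (does (w ≟ φ b) ∨ does (x ≟ φ b)) ∧ crossingEnd a b
          ≡⟨ cong (_∧ crossingEnd a b) (sym (edgeOn-N-c (φ b))) ⟩
        edgeOn c (φ b) N ∧ crossingEnd a b ∎
        where
        open ≡-Reasoning
        xv : joins a b (ψ x , v) ≡ does (x ≟ φ b) ∧ does (v ≟ a)
        xv rewrite dec-false (ψ x ≟ a) (ψ-≢C x≢c a∈C) | ψ-≟ x b∉C = refl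
        onPath : onPathToU a b v ≡ false
        onPath = any-none {xs = pairs q} (All.map (λ (≢b , ≢b′) → joins-avoidsʳ {u = a} ≢b ≢b′) (pathAvoids b b∉C))
        uw : joins a b (u , ψ w) ≡ (does (u ≟ a) ∧ does (w ≟ φ b)) ∨ false
        uw rewrite ψ-≟ w b∉C | dec-false (u ≟ b) (C-≢ u∈C b∉C) = refl
        crossing-∨ : (dx dw du dv e : Bool) → (dw ≡ true → dx ≡ false) → (dx ≡ true → e ≡ dv) →
          (dx ∧ dv) ∨ (false ∨ (((du ∧ dw) ∨ false) ∨ false)) ≡ (dw ∨ dx) ∧ (if dw then du else e)
        crossing-∨ true true _ _ _ dw⇒¬dx _ with dw⇒¬dx refl
        ... | ()
        crossing-∨ false true true _ _ _ _ = refl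
        crossing-∨ false true false _ _ _ _ = refl
        crossing-∨ true false true dv e _ dx⇒e≡dv = trans (∨-identityʳ dv) (sym (dx⇒e≡dv refl))
        crossing-∨ true false false dv e _ dx⇒e≡dv = trans (∨-identityʳ dv) (sym (dx⇒e≡dv refl))
        crossing-∨ false false true _ _ _ _ = refl
        crossing-∨ false false false _ _ _ _ = refl

      insideC-L : ∀ a b → a ∈ C → b ∈ C → edgeOn a b L ≡ xorSum (viaPath a b N) (allFin (n H))
      insideC-L a b a∈C b∈C = begin
        edgeOn a b L
          ≡⟨ edgeOn-L a b ⟩
        any (joins a b) (map ψ₂ PB) ∨ (joins a b (ψ x , v) ∨ (onPathToU a b v ∨ (joins a b (u , ψ w) ∨ false)))
          ≡⟨ cong₂ _∨_ (liftedAvoidsC a b a∈C) (cong₂ _∨_ (joins-avoids₁ {u = a} {v = b} {b = v} (ψ-≢C x≢c a∈C) (ψ-≢C x≢c b∈C))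
                                                          (cong (onPathToU a b v ∨_) (cong (_∨ false) (joins-avoids₂ {u = a} {v = b} {a = u} (ψ-≢C w≢c a∈C) (ψ-≢C w≢c b∈C))))) ⟩
        onPathToU a b v ∨ false
          ≡⟨ ∨-identityʳ _ ⟩
        onPathToU a b v
          ≡⟨ sym atX ⟩
        viaPath a b N x
          ≡⟨ sym (xorSum-unique (allFin⁺ (n H)) (∈-allFin x) elsewhere) ⟩
        xorSum (viaPath a b N) (allFin (n H)) ∎
        where
        open ≡-Reasoning
        atX : viaPath a b N x ≡ onPathToU a b v
        atX rewrite edgeOn-N-c x | dec-true (x ≟ x) refl | dec-false (x ≟ w) x≢w | ∨-zeroʳ (does (w ≟ x)) = refl
        elsewhere : ∀ y → y ≢ x → viaPath a b N y ≡ false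
        elsewhere y y≢x = decide (w ≟ y)
          where
          decide : Dec (w ≡ y) → viaPath a b N y ≡ false
          decide (yes refl) = trans (cong (λ t → edgeOn c w N ∧ (not t ∧ onPathToU a b (attach w))) (dec-true (w ≟ w) refl)) (∧-zeroʳ _)
          decide (no w≢y) = cong (_∧ (not (does (y ≟ w)) ∧ onPathToU a b (attach y)))
            (trans (edgeOn-N-c y) (cong₂ _∨_ (dec-false (w ≟ y) w≢y) (dec-false (x ≟ y) (y≢x ∘ sym))))

      lift : Lifts L N
      lift = record
        { good = record { isCycle = isCycle-L ; alternating = alternating-L ; evenlyOriented = evenlyOriented-L }
        ; outside = outside-L
        ; crossing = crossing-L
        ; insideC = insideC-L
        }

  module Family (𝒜 : List (List VH)) (good𝒜 : All (EvenAlternatingCycle FH OH) 𝒜)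
                (zeroSum : ∀ α β → Adj H α β → Even (countᵇ (edgeOn α β) 𝒜)) where

    UsesCx : VH → List VH → Set
    UsesCx x N = edgeOn c x N ≡ true

    neighbourOnC-𝒜 : {x : VH} → Any (UsesCx x) 𝒜 → Σ VG λ g → g ∈ C × Adj G (ψ x) g
    neighbourOnC-𝒜 atC with lookupAny good𝒜 atC
    ... | good , atX = neighbourOnC (edgeOn⇒Adj {K = H} (Any.lookup atC) (proj₂ (proj₂ (EvenAlternatingCycle.isCycle good))) atX)

    -- The same vertex of C must be used for every cycle through the edge cx, so it is chosen from the
    -- first member of 𝒜 containing that edge.
    attach : VH → VG
    attach x with any? (λ N → edgeOn c x N Bool.≟ true) 𝒜
    ... | yes atC = proj₁ (neighbourOnC-𝒜 atC)
    ... | no _ = u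

    attach-neighbour : {x : VH} {N : List VH} → N ∈ 𝒜 → UsesCx x N → attach x ∈ C × Adj G (ψ x) (attach x)
    attach-neighbour {x} N∈𝒜 atX with any? (λ N → edgeOn c x N Bool.≟ true) 𝒜
    ... | yes atC = proj₂ (neighbourOnC-𝒜 atC)
    ... | no ¬atC = ⊥-elim (¬atC (Any.map (λ { refl → atX }) N∈𝒜))

    open Lifting attach

    liftMember : (N : List VH) → N ∈ 𝒜 → Σ (List VG) λ L → Lifts L N
    liftMember N N∈𝒜 with c ∈?ᴴ N
    ... | no c∉N = map ψ N , liftAvoiding N good (All.tabulate (λ x∈N x≡c → c∉N (subst (_∈ N) x≡c x∈N)))
      where good = All.lookup good𝒜 N∈𝒜
    ... | yes c∈N with rotateToPartner FH OH c N (All.lookup good𝒜 N∈𝒜) c∈N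
    ...   | B , goodB , same = _ , Lifts-SameEdges (Through.lift B goodB (proj₁ neighbour) (proj₂ neighbour)) same
      where neighbour = attach-neighbour N∈𝒜 (trans (sym (same c (lastOf w B))) (edgeOn-closing c (w ∷ B)))

    lifted : Σ (List (List VG)) λ Ls → Pointwise Lifts Ls 𝒜
    lifted = All-Σ⇒Pointwise (All.tabulate (λ {N} N∈𝒜 → liftMember N N∈𝒜))

    liftedFamily : List (List VG)
    liftedFamily = proj₁ lifted

    liftedFamily-lifts : Pointwise Lifts liftedFamily 𝒜
    liftedFamily-lifts = proj₂ lifted

    Even-countᵇ-∧ : (p : List VH → Bool) (b : Bool) → Even (countᵇ p 𝒜) → Even (countᵇ (λ N → p N ∧ b) 𝒜)
    Even-countᵇ-∧ p true even = subst Even (sym (countᵇ-cong (All.tabulate {xs = 𝒜} (λ {N} _ → ∧-identityʳ (p N))))) even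
    Even-countᵇ-∧ p false _ = subst Even (sym (countᵇ-none (All.tabulate {xs = 𝒜} (λ {N} _ → ∧-zeroʳ (p N))))) refl

    xorSum-edgeOn-c : (y : VH) → xorSum (edgeOn c y) 𝒜 ≡ false
    xorSum-edgeOn-c y with any (edgeOn c y) 𝒜 in anyAtY
    ... | true with any⇒∃ (edgeOn c y) 𝒜 anyAtY
    ...   | N , N∈𝒜 , atY = trans (sym (oddᵇ-countᵇ (edgeOn c y) 𝒜))
                                  (Even⇒¬oddᵇ {countᵇ (edgeOn c y) 𝒜} (zeroSum c y (edgeOn⇒Adj {K = H} N adjacent atY)))
      where adjacent = proj₂ (proj₂ (EvenAlternatingCycle.isCycle (All.lookup good𝒜 N∈𝒜)))
    xorSum-edgeOn-c y | false = trans (sym (oddᵇ-countᵇ (edgeOn c y) 𝒜)) (cong oddᵇ (¬any⇒countᵇ≡0 (edgeOn c y) 𝒜 anyAtY))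

    zeroSum-crossing : (a b : VG) → Adj G a b → a ∈ C → b ∉ C → Even (countᵇ (edgeOn a b) liftedFamily)
    zeroSum-crossing a b adj a∈C b∉C =
      subst Even (sym (Pointwise-countᵇ (λ lifts → Lifts.crossing lifts a b a∈C b∉C) liftedFamily-lifts))
        (Even-countᵇ-∧ (edgeOn c (φ b)) (crossingEnd a b) (zeroSum c (φ b) (subst (λ x → Adj H x (φ b)) (φ-C a∈C) (Adj-φ adj (b∉C ∘ proj₂)))))

    -- Summing over 𝒜 first, every edge cy of H is met an even number of times.
    zeroSum-insideC : (a b : VG) → a ∈ C → b ∈ C → Even (countᵇ (edgeOn a b) liftedFamily)
    zeroSum-insideC a b a∈C b∈C = ¬oddᵇ⇒Even {countᵇ (edgeOn a b) liftedFamily} (begin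
      oddᵇ (countᵇ (edgeOn a b) liftedFamily)
        ≡⟨ oddᵇ-countᵇ (edgeOn a b) liftedFamily ⟩
      xorSum (edgeOn a b) liftedFamily
        ≡⟨ Pointwise-xorSum (λ lifts → Lifts.insideC lifts a b a∈C b∈C) liftedFamily-lifts ⟩
      xorSum (λ N → xorSum (viaPath a b N) (allFin (n H))) 𝒜
        ≡⟨ xorSum-swap (λ y N → viaPath a b N y) (allFin (n H)) 𝒜 ⟩
      xorSum (λ y → xorSum (λ N → viaPath a b N y) 𝒜) (allFin (n H))
        ≡⟨ xorSum-none (All.tabulate {xs = allFin (n H)} (λ {y} _ → vanishes y)) ⟩
      false ∎)
      where
      open ≡-Reasoning
      vanishes : (y : VH) → xorSum (λ N → viaPath a b N y) 𝒜 ≡ false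
      vanishes y = trans (xorSum-∧ʳ (edgeOn c y) (not (does (y ≟ w)) ∧ onPathToU a b (attach y)) 𝒜)
                         (cong (_∧ (not (does (y ≟ w)) ∧ onPathToU a b (attach y))) (xorSum-edgeOn-c y))

    zeroSum-G : ∀ a b → Adj G a b → Even (countᵇ (edgeOn a b) liftedFamily)
    zeroSum-G a b adj with a ∈? C | b ∈? C
    ... | yes a∈C | yes b∈C = zeroSum-insideC a b a∈C b∈C
    ... | yes a∈C | no b∉C = zeroSum-crossing a b adj a∈C b∉C
    ... | no a∉C | yes b∈C = subst Even (countᵇ-cong (All.tabulate {xs = liftedFamily} (λ {L} _ → edgeOn-sym b a L)))
                                 (zeroSum-crossing b a (Adj-sym G adj) b∈C a∉C)
    ... | no a∉C | no b∉C = subst Even (sym (Pointwise-countᵇ (λ lifts → Lifts.outside lifts a b a∉C b∉C) liftedFamily-lifts))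
                              (zeroSum (φ a) (φ b) (Adj-φ adj (a∉C ∘ proj₁)))

    simplyBad : Odd (length 𝒜) → SimplyBad G
    simplyBad odd = FG , liftedFamily , ((All.map isCycle goods , All.map alternating goods , zeroSum-G) , subst Odd (sym (Pointwise-length liftedFamily-lifts)) odd)
                  , OG , All.map evenlyOriented goods
      where
      open EvenAlternatingCycle
      goods : All (EvenAlternatingCycle FG OG) liftedFamily
      goods = Pointwise-All Lifts.good liftedFamily-lifts

lemma3p7 : (G H : Graph) → SimplyReducible G H → SimplyBad H → SimplyBad G
lemma3p7 G H ([] , (() , _) , _) _
lemma3p7 G H (c₀ ∷ C , cycleC , oddC , φ , φ-onto , φ-identifies , Adj-H)
             (FH , 𝒜 , ((cycles , alternating , zeroSum) , odd𝒜) , OH , evenlyOriented) =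
  Contraction.Family.simplyBad G H (c₀ ∷ C) c₀ (here refl) cycleC oddC φ φ-onto φ-identifies Adj-H FH OH 𝒜 good zeroSum odd𝒜
  where
  good : All (EvenAlternatingCycle FH OH) 𝒜
  good = All.zipWith (λ (cyc , alt , even) → record { isCycle = cyc ; alternating = alt ; evenlyOriented = even })
                     (cycles , All.zip (alternating , evenlyOriented))
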